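{- Let $p$ be any prime, $m$ a positive integer, $q=p^m$, $s>1$ a positive integer, and $a\in\mu_{q^2+q+1}=\{x\in\mathbb{F}_{q^3}: x^{q^2+q+1}=1\}$. Then $$f_5(X)=2X^{q^2}+(a+a^2)X^q+\left(a^{1+q^2}+a^{2(1+q^2)}\right)X+\mathrm{Tr}_m^{3m}(X)^s\in\mathbb{F}_{q^3}[X]$$ is a permutation polynomial of $\mathbb{F}_{q^3}$ if and only if $a\neq 1$ and $\gcd(s,q-1)=1$.
   Context: $\mathrm{Tr}_m^{3m}(X)=X+X^q+X^{q^2}$ is the relative trace from $\mathbb{F}_{q^3}$ to $\mathbb{F}_q$. A polynomial $f\in\mathbb{F}_{q^3}[X]$ is a permutation polynomial of $\mathbb{F}_{q^3}$ if $c\mapsto f(c)$ is a bijection of $\mathbb{F}_{q^3}$. -}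

module Defs where

open import Level using (0ℓ)
open import Data.Nat using (ℕ; zero; suc; _^_)
open import Data.Product using (Σ; _×_)
open import Relation.Binary.PropositionalEquality using (_≡_; _≢_)
open import Algebra.Structures using (IsCommutativeRing)

record Field : Set₁ where
  field
    Carrier : Set
    _+_ _*_ : Carrier → Carrier → Carrier
    -_      : Carrier → Carrier
    0# 1#   : Carrier
    isCommutativeRing : IsCommutativeRing _≡_ _+_ _*_ -_ 0# 1#
    0≢1     : 0# ≢ 1#
    inverse : (x : Carrier) → x ≢ 0# → Σ Carrier (λ y → x * y ≡ 1#)

  infixl 6 _+_
  infixl 7 _*_
  infixr 8 _^ᶠ_

  _^ᶠ_ : Carrier → ℕ → Carrier
  x ^ᶠ zero  = 1#
  x ^ᶠ suc n = x * (x ^ᶠ n)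

  2# : Carrier
  2# = 1# + 1#

module _ (F : Field) (q : ℕ) where
  open Field F

  Tr : Carrier → Carrier
  Tr x = x + x ^ᶠ q + x ^ᶠ (q ^ 2)

  f5 : (a : Carrier) (s : ℕ) → Carrier → Carrier
  f5 a s x = 2# * x ^ᶠ (q ^ 2)
           + (a + a ^ᶠ 2) * x ^ᶠ q
           + (a ^ᶠ (1 Data.Nat.+ q ^ 2) + a ^ᶠ (2 Data.Nat.* (1 Data.Nat.+ q ^ 2))) * x
           + Tr x ^ᶠ s

{-# OPTIONS --safe #-}

-- Write φ x = x ^ q: an automorphism of order 3 whose fixed points form F_q, and
-- f₅(x) = L(x) + Tr(x)^s with L linearised. For b of norm 1 the map
-- M_b(x) = φ²x + b φx + b φ²(b) x satisfies φ(M_b x) = φ(b) M_b x, and L = M_a + M_{a²}.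
-- If a ≠ 1, then whenever L(z) is fixed by φ, M_a z and M_{a²} z ("eigenvectors" for the
-- distinct eigenvalues φ(a), φ(a)² ≠ 1) vanish. For z = x − y with f₅(x) = f₅(y) this gives
-- L(z) = 0 and Tr(x)^s = Tr(y)^s; if s-th powers are injective on F_q, i.e. gcd(s, q − 1) = 1,
-- then also Tr(z) = 0, and z = 0 because M_a, M_{a²} and Tr have no common nonzero root.
-- Conversely, for a = 1 we have L = 2 Tr, so f₅ is constant on the kernel of the trace. For
-- a ≠ 1 both eigenspaces have at most q elements, so counting gives a nonzero root z of L,
-- and f₅(y z) = f₅(z) for any y ∈ F_q other than 1 with y^s = 1; such y exists when
-- gcd(s, q − 1) ≠ 1. On a finite set injectivity is bijectivity.

module Submission where

open import Level using (0ℓ)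
open import Function using (_∘_; id)
open import Function.Bundles using (_↔_; _⇔_; Inverse; Injection; mk↔ₛ′; mk⇔)
open import Function.Construct.Composition using (_↔-∘_)
open import Function.Definitions using (Injective; Surjective; Bijective)
open import Function.Properties.Inverse using (↔-sym; Inverse⇒Injection)
open import Data.Empty using (⊥-elim)
open import Data.Sum using (inj₁; inj₂)
open import Data.Product using (∃; _×_; _,_; proj₁; proj₂)
import Data.Maybe as Maybe
open import Relation.Nullary using (¬_; yes; no; dec⇒maybe)
open import Relation.Nullary.Decidable using (via-injection; decidable-stable; _→-dec_)
open import Relation.Unary using (Decidable)
open import Relation.Binary.Definitions using (DecidableEquality)
open import Relation.Binary.PropositionalEquality

open import Data.Nat as ℕ using (ℕ; zero; suc; _∸_; z≤n; s≤s; NonZero; _!)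
import Data.Nat.Properties as ℕₚ
open import Data.Nat.Properties using (_!*_!≢0)
open import Data.Nat.Tactic.RingSolver using (solve-∀)
open import Data.Nat.Divisibility using (_∣_; _∤_; divides; ∣⇒≤; >⇒∤; m∣m*n; n∣m*n)
open import Data.Nat.DivMod using (m/n*n≡m)
open import Data.Nat.Combinatorics using (_C_; nCn≡1; nCk≡n!/k![n-k]!; k![n∸k]!∣n!)
open import Data.Nat.GCD using (gcd; gcd-GCD; module Bézout; gcd[m,n]∣m; gcd[m,n]∣n; gcd[m,n]≡0⇒n≡0)
open import Data.Nat.Primality using (Prime; prime⇒nonTrivial; prime⇒nonZero; euclidsLemma)
open import Algebra.Properties.CommutativeSemigroup ℕₚ.*-commutativeSemigroup using (xy∙z≈xz∙y)
open import Data.Integer as ℤ using (ℤ; -[1+_]; _⊖_) renaming (+_ to pos)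
import Data.Integer.Properties as ℤₚ
open import Data.Fin as Fin using (Fin; fromℕ; inject₁; toℕ)
import Data.Fin.Properties as Finₚ

open import Data.List using (List; []; _∷_; length; replicate; _++_; tabulate; filter)
open import Data.List.Properties using (length-++; length-replicate; length-tabulate)
open import Data.List.Relation.Unary.All as All using (All; []; _∷_)
import Data.List.Relation.Unary.All.Properties as Allₚ
import Data.List.Relation.Unary.Any as Any
open import Data.List.Relation.Unary.AllPairs using ([]; _∷_)
open import Data.List.Relation.Unary.Unique.Propositional using (Unique)
import Data.List.Relation.Unary.Unique.Propositional.Properties as Uniqueₚ
open import Data.List.Membership.Propositional using (_∈_)
open import Data.List.Membership.Propositional.Properties using (∈-tabulate⁺; ∈-filter⁺)
open import Data.List.Membership.Setoid.Properties using (index-injective)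

open import Algebra.Bundles using (CommutativeMonoid; CommutativeRing)
import Algebra.Solver.Ring
open import Algebra.Solver.Ring.AlmostCommutativeRing
  using (fromCommutativeRing; _-Raw-AlmostCommutative⟶_)

open import Defs

prime⇒1<p : ∀ {p} → Prime p → 1 ℕ.< p
prime⇒1<p {p} pp = ℕ.nonTrivial⇒n>1 p {{prime⇒nonTrivial pp}}

prime∤n! : ∀ {p n} → Prime p → n ℕ.< p → p ∤ n !
prime∤n! {n = zero}  pp _   = >⇒∤ (prime⇒1<p pp)
prime∤n! {n = suc n} pp n<p p∣ with euclidsLemma (suc n) (n !) pp p∣
... | inj₁ p∣1+n = ℕₚ.<⇒≱ n<p (∣⇒≤ p∣1+n)
... | inj₂ p∣n!  = prime∤n! pp (ℕₚ.<-trans (ℕₚ.n<1+n n) n<p) p∣n!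

n∣n! : ∀ n → .{{NonZero n}} → n ∣ n !
n∣n! (suc n) = m∣m*n (n !)

nCk*k![n∸k]!≡n! : ∀ {n k} → k ℕ.≤ n → (n C k) ℕ.* (k ! ℕ.* (n ∸ k) !) ≡ n !
nCk*k![n∸k]!≡n! {n} {k} k≤n = begin
  (n C k) ℕ.* (k ! ℕ.* (n ∸ k) !)                       ≡⟨ cong (ℕ._* (k ! ℕ.* (n ∸ k) !)) (nCk≡n!/k![n-k]! k≤n) ⟩
  (n ! ℕ./ (k ! ℕ.* (n ∸ k) !)) ℕ.* (k ! ℕ.* (n ∸ k) !) ≡⟨ m/n*n≡m (k![n∸k]!∣n! k≤n) ⟩
  n !                                                   ∎
  where
  open ≡-Reasoning
  instance
    k![n∸k]!≢0 : NonZero (k ! ℕ.* (n ∸ k) !)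
    k![n∸k]!≢0 = k !* (n ∸ k) !≢0

prime∣pCk : ∀ {p k} → Prime p → 0 ℕ.< k → k ℕ.< p → p ∣ p C k
prime∣pCk {p} {k} pp 0<k k<p
  with euclidsLemma (p C k) (k ! ℕ.* (p ∸ k) !) pp
         (subst (p ∣_) (sym (nCk*k![n∸k]!≡n! (ℕₚ.<⇒≤ k<p))) (n∣n! p {{prime⇒nonZero pp}}))
... | inj₁ p∣pCk = p∣pCk
... | inj₂ p∣k![p∸k]! with euclidsLemma (k !) ((p ∸ k) !) pp p∣k![p∸k]!
...   | inj₁ p∣k!     = ⊥-elim (prime∤n! pp k<p p∣k!)
...   | inj₂ p∣[p∸k]! = ⊥-elim (prime∤n! pp (ℕₚ.∸-monoʳ-< 0<k (ℕₚ.<⇒≤ k<p)) p∣[p∸k]!)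

[1+k]³≡1+k*[[1+k]²+[1+k]+1] : ∀ k →
  suc k ℕ.* (suc k ℕ.* suc k) ≡ suc (k ℕ.* (suc k ℕ.* suc k ℕ.+ suc k ℕ.+ 1))
[1+k]³≡1+k*[[1+k]²+[1+k]+1] = solve-∀

≢0∧≢1⇒2≤ : ∀ {n} → n ≢ 0 → n ≢ 1 → 2 ℕ.≤ n
≢0∧≢1⇒2≤ {0}           n≢0 _   = ⊥-elim (n≢0 refl)
≢0∧≢1⇒2≤ {1}           _   n≢1 = ⊥-elim (n≢1 refl)
≢0∧≢1⇒2≤ {suc (suc n)} _   _   = s≤s (s≤s z≤n)

injective-≗ : ∀ {A B : Set} {f g : A → B} → f ≗ g → Injective _≡_ _≡_ f → Injective _≡_ _≡_ g
injective-≗ f≗g f-injective {x} {y} gx≡gy = f-injective (trans (f≗g x) (trans gx≡gy (sym (f≗g y))))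

Fin-injective⇒surjective : ∀ {n} {f : Fin n → Fin n} → Injective _≡_ _≡_ f → ∀ y → ∃ λ x → f x ≡ y
Fin-injective⇒surjective {suc n} {f} f-injective y with Finₚ.any? (λ x → f x Fin.≟ y)
... | yes found = found
... | no  none  = ⊥-elim (ℕₚ.1+n≰n (Finₚ.injective⇒≤ punchOut-injective))
  where
  y≢f : ∀ x → y ≢ f x
  y≢f x y≡fx = none (x , sym y≡fx)
  punchOut-injective : Injective _≡_ _≡_ (λ x → Fin.punchOut (y≢f x))
  punchOut-injective {x} {x′} eq = f-injective (Finₚ.punchOut-injective (y≢f x) (y≢f x′) eq)

AtMost : {A : Set} → ℕ → (A → Set) → Set
AtMost k P = ∀ {xs} → Unique xs → All P xs → length xs ℕ.≤ k

module FieldProperties (F : Field) where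

  open Field F public
  open ≡-Reasoning

  commutativeRing : CommutativeRing 0ℓ 0ℓ
  commutativeRing = record { isCommutativeRing = isCommutativeRing }

  open CommutativeRing commutativeRing public
    using ( +-assoc; +-comm; +-identityˡ; +-identityʳ; -‿inverseʳ
          ; *-assoc; *-comm; *-identityˡ; *-identityʳ; zeroˡ; zeroʳ
          ; ring; semiring; commutativeSemiring; +-commutativeMonoid; *-commutativeMonoid )
  open import Algebra.Properties.Ring ring public
    using (-‿distribˡ-*; -‿distribʳ-*; -‿involutive; -‿+-comm; -0#≈0#; x∙y⁻¹≈ε⇒x≈y; +-cancelˡ)

  infixl 6 _-_
  _-_ : Carrier → Carrier → Carrier
  x - y = x + - y

  -- The ring solver normalises coefficients, so they must live in a ring with decidable equality:
  -- we use ℤ, mapped into F by ι. The optimised multiple _·′_ satisfies 1 ·′ x = x definitionally,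
  -- so that the solver constant :1 below denotes 1# itself.
  private
    open import Algebra.Properties.Semiring.Mult.TCOptimised semiring
      using (1+×; ×-homo-+; ×1-homo-*) renaming (_×_ to _·′_)

    ι : ℤ → Carrier
    ι (pos n)  = n ·′ 1#
    ι -[1+ n ] = - (suc n ·′ 1#)

    x-0≡x : ∀ x → x - 0# ≡ x
    x-0≡x x = trans (cong (x +_) -0#≈0#) (+-identityʳ x)

    [1+x]-[1+y]≡x-y : ∀ x y → (1# + x) - (1# + y) ≡ x - y
    [1+x]-[1+y]≡x-y x y = begin
      (1# + x) + - (1# + y)   ≡⟨ cong ((1# + x) +_) (-‿+-comm 1# y) ⟨
      (1# + x) + (- 1# + - y) ≡⟨ cong (_+ (- 1# + - y)) (+-comm 1# x) ⟩
      (x + 1#) + (- 1# + - y) ≡⟨ +-assoc x 1# _ ⟩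
      x + (1# + (- 1# + - y)) ≡⟨ cong (x +_) (+-assoc 1# (- 1#) (- y)) ⟨
      x + ((1# - 1#) + - y)   ≡⟨ cong (λ z → x + (z + - y)) (-‿inverseʳ 1#) ⟩
      x + (0# + - y)          ≡⟨ cong (x +_) (+-identityˡ (- y)) ⟩
      x - y                   ∎

    ι-⊖ : ∀ m n → ι (m ⊖ n) ≡ m ·′ 1# - n ·′ 1#
    ι-⊖ m       zero    = sym (x-0≡x _)
    ι-⊖ zero    (suc n) = sym (+-identityˡ _)
    ι-⊖ (suc m) (suc n) = begin
      ι (suc m ⊖ suc n)               ≡⟨ cong ι (ℤₚ.[1+m]⊖[1+n]≡m⊖n m n) ⟩
      ι (m ⊖ n)                       ≡⟨ ι-⊖ m n ⟩
      m ·′ 1# - n ·′ 1#               ≡⟨ [1+x]-[1+y]≡x-y _ _ ⟨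
      (1# + m ·′ 1#) - (1# + n ·′ 1#) ≡⟨ cong₂ _-_ (1+× m 1#) (1+× n 1#) ⟨
      suc m ·′ 1# - suc n ·′ 1#       ∎

    ι-+ : ∀ i j → ι (i ℤ.+ j) ≡ ι i + ι j
    ι-+ (pos m)  (pos n)  = ×-homo-+ 1# m n
    ι-+ (pos m)  -[1+ n ] = ι-⊖ m (suc n)
    ι-+ -[1+ m ] (pos n)  = trans (ι-⊖ n (suc m)) (+-comm _ _)
    ι-+ -[1+ m ] -[1+ n ] = begin
      - (suc (suc (m ℕ.+ n)) ·′ 1#)      ≡⟨ cong (λ k → - (k ·′ 1#)) (cong suc (ℕₚ.+-suc m n)) ⟨
      - ((suc m ℕ.+ suc n) ·′ 1#)        ≡⟨ cong -_ (×-homo-+ 1# (suc m) (suc n)) ⟩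
      - (suc m ·′ 1# + suc n ·′ 1#)      ≡⟨ -‿+-comm _ _ ⟨
      - (suc m ·′ 1#) + - (suc n ·′ 1#)  ∎

    ι-* : ∀ i j → ι (i ℤ.* j) ≡ ι i * ι j
    ι-* (pos zero)    j             = sym (zeroˡ _)
    ι-* (pos (suc m)) (pos zero)    = trans (cong ι (ℤₚ.*-zeroʳ (pos (suc m)))) (sym (zeroʳ _))
    ι-* (pos (suc m)) (pos (suc n)) = ×1-homo-* (suc m) (suc n)
    ι-* (pos (suc m)) -[1+ n ]      = trans (cong -_ (×1-homo-* (suc m) (suc n))) (-‿distribʳ-* _ _)
    ι-* -[1+ m ]      (pos zero)    = trans (cong ι (ℤₚ.*-zeroʳ -[1+ m ])) (sym (zeroʳ _))
    ι-* -[1+ m ]      (pos (suc n)) = trans (cong -_ (×1-homo-* (suc m) (suc n))) (-‿distribˡ-* _ _)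
    ι-* -[1+ m ]      -[1+ n ]      = begin
      (suc m ℕ.* suc n) ·′ 1#            ≡⟨ ×1-homo-* (suc m) (suc n) ⟩
      suc m ·′ 1# * suc n ·′ 1#          ≡⟨ -‿involutive _ ⟨
      - - (suc m ·′ 1# * suc n ·′ 1#)    ≡⟨ cong -_ (-‿distribˡ-* _ _) ⟩
      - (- (suc m ·′ 1#) * suc n ·′ 1#)  ≡⟨ -‿distribʳ-* _ _ ⟩
      - (suc m ·′ 1#) * - (suc n ·′ 1#)  ∎

    ι-‿ : ∀ i → ι (ℤ.- i) ≡ - ι i
    ι-‿ (pos zero)    = sym -0#≈0#
    ι-‿ (pos (suc n)) = refl
    ι-‿ -[1+ n ]      = sym (-‿involutive _)

    ℤ⟶F : ℤ.+-*-rawRing -Raw-AlmostCommutative⟶ fromCommutativeRing commutativeRing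
    ℤ⟶F = record
      { ⟦_⟧ = ι ; +-homo = ι-+ ; *-homo = ι-* ; -‿homo = ι-‿ ; 0-homo = refl ; 1-homo = refl }

    module Solver = Algebra.Solver.Ring ℤ.+-*-rawRing (fromCommutativeRing commutativeRing) ℤ⟶F
      (λ i j → Maybe.map (cong ι) (dec⇒maybe (i ℤ.≟ j)))

  open Solver public using (solve; _:=_; _:+_; _:*_; _:-_; :-_) renaming (Polynomial to Expr)

  :0 : ∀ {n} → Expr n
  :0 = Solver.con (pos 0)

  :1 : ∀ {n} → Expr n
  :1 = Solver.con (pos 1)

  open import Algebra.Properties.Semiring.Exp semiring using (_^_; ^-homo-*; ^-assocʳ)
  open import Algebra.Properties.CommutativeSemiring.Exp commutativeSemiring using (^-distrib-*)
  open import Algebra.Properties.Semiring.Mult semiring public using () renaming (_×_ to _·_)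
  open import Algebra.Properties.Semiring.Mult semiring using (×-homo-1) renaming (×1-homo-* to ·1-homo-*)
  open import Algebra.Properties.CommutativeMonoid.Sum *-commutativeMonoid using ()
    renaming ( sum to product; sum-cong-≗ to product-cong-≗
             ; ∑-distrib-+ to ∏-distrib-*; sum-replicate to product-replicate )

  ^ᶠ≡^ : ∀ x n → x ^ᶠ n ≡ x ^ n
  ^ᶠ≡^ x zero    = refl
  ^ᶠ≡^ x (suc n) = cong (x *_) (^ᶠ≡^ x n)

  ^ᶠ-distribˡ-+-* : ∀ x m n → x ^ᶠ (m ℕ.+ n) ≡ x ^ᶠ m * x ^ᶠ n
  ^ᶠ-distribˡ-+-* x m n = begin
    x ^ᶠ (m ℕ.+ n)  ≡⟨ ^ᶠ≡^ x (m ℕ.+ n) ⟩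
    x ^ (m ℕ.+ n)   ≡⟨ ^-homo-* x m n ⟩
    x ^ m * x ^ n   ≡⟨ cong₂ _*_ (^ᶠ≡^ x m) (^ᶠ≡^ x n) ⟨
    x ^ᶠ m * x ^ᶠ n ∎

  ^ᶠ-*-assoc : ∀ x m n → (x ^ᶠ m) ^ᶠ n ≡ x ^ᶠ (m ℕ.* n)
  ^ᶠ-*-assoc x m n = begin
    (x ^ᶠ m) ^ᶠ n  ≡⟨ ^ᶠ≡^ (x ^ᶠ m) n ⟩
    (x ^ᶠ m) ^ n   ≡⟨ cong (_^ n) (^ᶠ≡^ x m) ⟩
    (x ^ m) ^ n    ≡⟨ ^-assocʳ x m n ⟩
    x ^ (m ℕ.* n)  ≡⟨ ^ᶠ≡^ x (m ℕ.* n) ⟨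
    x ^ᶠ (m ℕ.* n) ∎

  ^ᶠ-distribʳ-* : ∀ x y n → (x * y) ^ᶠ n ≡ x ^ᶠ n * y ^ᶠ n
  ^ᶠ-distribʳ-* x y n = begin
    (x * y) ^ᶠ n    ≡⟨ ^ᶠ≡^ (x * y) n ⟩
    (x * y) ^ n     ≡⟨ ^-distrib-* x y n ⟩
    x ^ n * y ^ n   ≡⟨ cong₂ _*_ (^ᶠ≡^ x n) (^ᶠ≡^ y n) ⟨
    x ^ᶠ n * y ^ᶠ n ∎

  1^ᶠn≡1 : ∀ n → 1# ^ᶠ n ≡ 1#
  1^ᶠn≡1 zero    = refl
  1^ᶠn≡1 (suc n) = trans (*-identityˡ _) (1^ᶠn≡1 n)

  0^ᶠn≡0 : ∀ n .{{_ : NonZero n}} → 0# ^ᶠ n ≡ 0#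
  0^ᶠn≡0 (suc n) = zeroˡ _

  x≢0⇒x*y≡0⇒y≡0 : ∀ {x y} → x ≢ 0# → x * y ≡ 0# → y ≡ 0#
  x≢0⇒x*y≡0⇒y≡0 {x} {y} x≢0 xy≡0 = begin
    y             ≡⟨ *-identityˡ y ⟨
    1# * y        ≡⟨ cong (_* y) (trans (*-comm x⁻¹ x) x*x⁻¹≡1) ⟨
    (x⁻¹ * x) * y ≡⟨ *-assoc x⁻¹ x y ⟩
    x⁻¹ * (x * y) ≡⟨ cong (x⁻¹ *_) xy≡0 ⟩
    x⁻¹ * 0#      ≡⟨ zeroʳ x⁻¹ ⟩
    0#            ∎
    where
    x⁻¹ : Carrier
    x⁻¹ = proj₁ (inverse x x≢0)
    x*x⁻¹≡1 : x * x⁻¹ ≡ 1#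
    x*x⁻¹≡1 = proj₂ (inverse x x≢0)

  *-≢0 : ∀ {x y} → x ≢ 0# → y ≢ 0# → x * y ≢ 0#
  *-≢0 x≢0 y≢0 xy≡0 = y≢0 (x≢0⇒x*y≡0⇒y≡0 x≢0 xy≡0)

  ^ᶠ-≢0 : ∀ {x} n → x ≢ 0# → x ^ᶠ n ≢ 0#
  ^ᶠ-≢0 zero    x≢0 = 0≢1 ∘ sym
  ^ᶠ-≢0 (suc n) x≢0 = *-≢0 x≢0 (^ᶠ-≢0 n x≢0)

  x≢y⇒x-y≢0 : ∀ {x y} → x ≢ y → x - y ≢ 0#
  x≢y⇒x-y≢0 x≢y x-y≡0 = x≢y (x∙y⁻¹≈ε⇒x≈y _ _ x-y≡0)

  *-cancelˡ : ∀ {x y z} → x ≢ 0# → x * y ≡ x * z → y ≡ z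
  *-cancelˡ {x} {y} {z} x≢0 xy≡xz = x∙y⁻¹≈ε⇒x≈y y z (x≢0⇒x*y≡0⇒y≡0 x≢0 (begin
    x * (y - z)   ≡⟨ solve 3 (λ x y z → x :* (y :- z) := x :* y :- x :* z) refl x y z ⟩
    x * y - x * z ≡⟨ cong (_- x * z) xy≡xz ⟩
    x * z - x * z ≡⟨ -‿inverseʳ (x * z) ⟩
    0#            ∎))

  translation : Carrier → Carrier ↔ Carrier
  translation c = mk↔ₛ′ (_+ c) (_- c)
    (λ x → solve 2 (λ x c → (x :- c) :+ c := x) refl x c)
    (λ x → solve 2 (λ x c → (x :+ c) :- c := x) refl x c)

  scaling : ∀ {c} → c ≢ 0# → Carrier ↔ Carrier
  scaling {c} c≢0 = mk↔ₛ′ (c *_) (c⁻¹ *_)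
    (λ x → trans (sym (*-assoc c c⁻¹ x)) (trans (cong (_* x) c*c⁻¹≡1) (*-identityˡ x)))
    (λ x → trans (sym (*-assoc c⁻¹ c x)) (trans (cong (_* x) (trans (*-comm c⁻¹ c) c*c⁻¹≡1)) (*-identityˡ x)))
    where
    c⁻¹ : Carrier
    c⁻¹ = proj₁ (inverse c c≢0)
    c*c⁻¹≡1 : c * c⁻¹ ≡ 1#
    c*c⁻¹≡1 = proj₂ (inverse c c≢0)

  ·1-homo-^ : ∀ n j → (n ℕ.^ j) · 1# ≡ (n · 1#) ^ᶠ j
  ·1-homo-^ n zero    = ×-homo-1 1#
  ·1-homo-^ n (suc j) = trans (·1-homo-* n (n ℕ.^ j)) (cong ((n · 1#) *_) (·1-homo-^ n j))

  ^ᶠ≡1-∣ : ∀ {x d n} → d ∣ n → x ^ᶠ d ≡ 1# → x ^ᶠ n ≡ 1#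
  ^ᶠ≡1-∣ {x} {d} (divides j refl) x^d≡1 = begin
    x ^ᶠ (j ℕ.* d) ≡⟨ cong (x ^ᶠ_) (ℕₚ.*-comm j d) ⟩
    x ^ᶠ (d ℕ.* j) ≡⟨ ^ᶠ-*-assoc x d j ⟨
    (x ^ᶠ d) ^ᶠ j  ≡⟨ cong (_^ᶠ j) x^d≡1 ⟩
    1# ^ᶠ j        ≡⟨ 1^ᶠn≡1 j ⟩
    1#             ∎

  ^ᶠ≡1-gcd : ∀ {x} m n → x ^ᶠ m ≡ 1# → x ^ᶠ n ≡ 1# → x ^ᶠ gcd m n ≡ 1#
  ^ᶠ≡1-gcd {x} m n x^m≡1 x^n≡1 = from-identity (Bézout.identity (gcd-GCD m n))
    where
    cancel-powers : ∀ {a b d} → x ^ᶠ a ≡ 1# → x ^ᶠ b ≡ 1# →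
                    ∀ i j → d ℕ.+ i ℕ.* a ≡ j ℕ.* b → x ^ᶠ d ≡ 1#
    cancel-powers {a} {b} {d} x^a≡1 x^b≡1 i j d+ia≡jb = begin
      x ^ᶠ d                  ≡⟨ *-identityʳ _ ⟨
      x ^ᶠ d * 1#             ≡⟨ cong (x ^ᶠ d *_) (^ᶠ≡1-∣ (n∣m*n i) x^a≡1) ⟨
      x ^ᶠ d * x ^ᶠ (i ℕ.* a) ≡⟨ ^ᶠ-distribˡ-+-* x d (i ℕ.* a) ⟨
      x ^ᶠ (d ℕ.+ i ℕ.* a)    ≡⟨ cong (x ^ᶠ_) d+ia≡jb ⟩
      x ^ᶠ (j ℕ.* b)          ≡⟨ ^ᶠ≡1-∣ (n∣m*n j) x^b≡1 ⟩
      1#                      ∎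
    from-identity : Bézout.Identity (gcd m n) m n → x ^ᶠ gcd m n ≡ 1#
    from-identity (Bézout.+- i j d+jn≡im) = cancel-powers x^n≡1 x^m≡1 j i d+jn≡im
    from-identity (Bézout.-+ i j d+im≡jn) = cancel-powers x^m≡1 x^n≡1 i j d+im≡jn

  product-≢0 : ∀ {n} (u : Fin n → Carrier) → (∀ i → u i ≢ 0#) → product u ≢ 0#
  product-≢0 {zero}  u u≢0 = 0≢1 ∘ sym
  product-≢0 {suc n} u u≢0 = *-≢0 (u≢0 Fin.zero) (product-≢0 (u ∘ Fin.suc) (u≢0 ∘ Fin.suc))

  product-scale : ∀ {n} c (u : Fin n → Carrier) → product (λ i → c * u i) ≡ c ^ᶠ n * product u
  product-scale {n} c u = begin
    product (λ i → c * u i)            ≡⟨ ∏-distrib-* (λ _ → c) u ⟩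
    product {n} (λ _ → c) * product u  ≡⟨ cong (_* product u) (product-replicate n) ⟩
    c ^ n * product u                  ≡⟨ cong (_* product u) (^ᶠ≡^ c n) ⟨
    c ^ᶠ n * product u                 ∎

  product-update : ∀ {n} (u v : Fin n → Carrier) i₀ c →
                   u i₀ ≡ c * v i₀ → (∀ i → i ≢ i₀ → u i ≡ v i) → product u ≡ c * product v
  product-update {suc n} u v Fin.zero c u≡cv u≡v =
    trans (cong₂ _*_ u≡cv (product-cong-≗ (λ i → u≡v (Fin.suc i) λ ())) ) (*-assoc c _ _)
  product-update {suc n} u v (Fin.suc i₀) c u≡cv u≡v = begin
    u Fin.zero * product (u ∘ Fin.suc)
      ≡⟨ cong₂ _*_ (u≡v Fin.zero λ ()) (product-update (u ∘ Fin.suc) (v ∘ Fin.suc) i₀ c u≡cv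
                     (λ i i≢i₀ → u≡v (Fin.suc i) (i≢i₀ ∘ Finₚ.suc-injective))) ⟩
    v Fin.zero * (c * product (v ∘ Fin.suc))
      ≡⟨ solve 3 (λ a c b → a :* (c :* b) := c :* (a :* b)) refl (v Fin.zero) c _ ⟩
    c * (v Fin.zero * product (v ∘ Fin.suc))
      ∎

module Frobenius (F : Field) where

  open FieldProperties F
  open ≡-Reasoning
  open import Algebra.Properties.Semiring.Exp semiring using (_^_)
  open import Algebra.Properties.Semiring.Mult semiring using (×-homo-1; ×-assoc-*) renaming (×1-homo-* to ·1-homo-*)
  open import Algebra.Properties.CommutativeMonoid.Sum +-commutativeMonoid
    using (sum; sum-cong-≗; sum-init-last; sum-replicate-zero)
  open import Algebra.Properties.CommutativeSemiring.Binomial commutativeSemiring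
    using (binomialTerm) renaming (theorem to binomial-theorem)

  p∣n⇒n·x≡0 : ∀ {p n} → p · 1# ≡ 0# → p ∣ n → ∀ x → n · x ≡ 0#
  p∣n⇒n·x≡0 {p} char (divides t refl) x = begin
    (t ℕ.* p) · x             ≡⟨ cong ((t ℕ.* p) ·_) (*-identityˡ x) ⟨
    (t ℕ.* p) · (1# * x)      ≡⟨ ×-assoc-* (t ℕ.* p) 1# x ⟨
    ((t ℕ.* p) · 1#) * x      ≡⟨ cong (_* x) (·1-homo-* t p) ⟩
    ((t · 1#) * (p · 1#)) * x ≡⟨ cong (λ c → ((t · 1#) * c) * x) char ⟩
    ((t · 1#) * 0#) * x       ≡⟨ solve 2 (λ a x → (a :* :0) :* x := :0) refl (t · 1#) x ⟩
    0#                        ∎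

  ∑-first+last : ∀ {n} (t : Fin (suc (suc n)) → Carrier) →
                 (∀ j → t (Fin.suc (inject₁ j)) ≡ 0#) → sum t ≡ t Fin.zero + t (fromℕ (suc n))
  ∑-first+last {n} t interior≡0 = cong (t Fin.zero +_) (begin
    sum (t ∘ Fin.suc)                               ≡⟨ sum-init-last (t ∘ Fin.suc) ⟩
    sum (t ∘ Fin.suc ∘ inject₁) + t (fromℕ (suc n)) ≡⟨ cong (_+ t (fromℕ (suc n))) (sum-cong-≗ interior≡0) ⟩
    sum {n} (λ _ → 0#) + t (fromℕ (suc n))          ≡⟨ cong (_+ t (fromℕ (suc n))) (sum-replicate-zero n) ⟩
    0# + t (fromℕ (suc n))                          ≡⟨ +-identityˡ _ ⟩
    t (fromℕ (suc n))                               ∎)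

  frobenius : ∀ {p} → Prime p → p · 1# ≡ 0# → ∀ x y → (x + y) ^ᶠ p ≡ x ^ᶠ p + y ^ᶠ p
  frobenius {0} pp with prime⇒1<p pp
  ... | ()
  frobenius {1} pp with prime⇒1<p pp
  ... | s≤s ()
  frobenius {p@(suc (suc r))} pp char x y = begin
    (x + y) ^ᶠ p                     ≡⟨ ^ᶠ≡^ (x + y) p ⟩
    (x + y) ^ p                      ≡⟨ binomial-theorem p x y ⟩
    sum (term p)                     ≡⟨ ∑-first+last (term p) interior≡0 ⟩
    term p Fin.zero + term p (fromℕ p) ≡⟨ cong₂ _+_ first≡y^p last≡x^p ⟩
    y ^ᶠ p + x ^ᶠ p                  ≡⟨ +-comm _ _ ⟩
    x ^ᶠ p + y ^ᶠ p                  ∎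
    where
    term : (n : ℕ) → Fin (suc n) → Carrier
    term = binomialTerm x y
    interior≡0 : ∀ j → term p (Fin.suc (inject₁ j)) ≡ 0#
    interior≡0 j = p∣n⇒n·x≡0 char (prime∣pCk pp (s≤s z≤n) (s≤s (s≤s k≤r))) _
      where
      k≤r : toℕ (inject₁ j) ℕ.≤ r
      k≤r = subst (ℕ._≤ r) (sym (Finₚ.toℕ-inject₁ j)) (Finₚ.toℕ≤pred[n] j)
    first≡y^p : term p Fin.zero ≡ y ^ᶠ p
    first≡y^p = trans (×-homo-1 _) (trans (*-identityˡ _) (sym (^ᶠ≡^ y p)))
    last≡x^p : term p (fromℕ p) ≡ x ^ᶠ p
    last≡x^p = begin
      term p (fromℕ p)                ≡⟨ cong (λ k → (p C k) · (x ^ k * y ^ (p ∸ k))) (Finₚ.toℕ-fromℕ p) ⟩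
      (p C p) · (x ^ p * y ^ (p ∸ p)) ≡⟨ cong₂ (λ c k → c · (x ^ p * y ^ k)) (nCn≡1 p) (ℕₚ.n∸n≡0 p) ⟩
      1 · (x ^ p * 1#)                ≡⟨ trans (×-homo-1 _) (*-identityʳ _) ⟩
      x ^ p                           ≡⟨ ^ᶠ≡^ x p ⟨
      x ^ᶠ p                          ∎

  frobenius-^ : ∀ {p} → Prime p → p · 1# ≡ 0# → ∀ k x y →
                (x + y) ^ᶠ (p ℕ.^ k) ≡ x ^ᶠ (p ℕ.^ k) + y ^ᶠ (p ℕ.^ k)
  frobenius-^ pp char zero    x y = trans (*-identityʳ _) (sym (cong₂ _+_ (*-identityʳ x) (*-identityʳ y)))
  frobenius-^ {p} pp char (suc k) x y = begin
    (x + y) ^ᶠ (p ℕ.* p ℕ.^ k)                   ≡⟨ ^ᶠ-*-assoc (x + y) p (p ℕ.^ k) ⟨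
    ((x + y) ^ᶠ p) ^ᶠ (p ℕ.^ k)                  ≡⟨ cong (_^ᶠ (p ℕ.^ k)) (frobenius pp char x y) ⟩
    (x ^ᶠ p + y ^ᶠ p) ^ᶠ (p ℕ.^ k)               ≡⟨ frobenius-^ pp char k (x ^ᶠ p) (y ^ᶠ p) ⟩
    (x ^ᶠ p) ^ᶠ (p ℕ.^ k) + (y ^ᶠ p) ^ᶠ (p ℕ.^ k) ≡⟨ cong₂ _+_ (^ᶠ-*-assoc x p _) (^ᶠ-*-assoc y p _) ⟩
    x ^ᶠ (p ℕ.* p ℕ.^ k) + y ^ᶠ (p ℕ.* p ℕ.^ k)   ∎

module Polynomials (F : Field) where

  open FieldProperties F
  open ≡-Reasoning

  Polynomial : Set
  Polynomial = List Carrier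

  eval : Polynomial → Carrier → Carrier
  eval []       x = 0#
  eval (c ∷ cs) x = c + x * eval cs x

  quotient : Carrier → Polynomial → Polynomial
  quotient r []           = []
  quotient r (c ∷ [])     = []
  quotient r (c ∷ d ∷ cs) = eval (d ∷ cs) r ∷ quotient r (d ∷ cs)

  eval≡[x-r]*quotient+eval[r] : ∀ r P x → eval P x ≡ (x - r) * eval (quotient r P) x + eval P r
  eval≡[x-r]*quotient+eval[r] r [] x =
    solve 2 (λ x r → :0 := (x :- r) :* :0 :+ :0) refl x r
  eval≡[x-r]*quotient+eval[r] r (c ∷ []) x =
    solve 3 (λ c x r → c :+ x :* :0 := (x :- r) :* :0 :+ (c :+ r :* :0)) refl c x r
  eval≡[x-r]*quotient+eval[r] r (c ∷ d ∷ cs) x = begin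
    c + x * eval (d ∷ cs) x           ≡⟨ cong (λ e → c + x * e) (eval≡[x-r]*quotient+eval[r] r (d ∷ cs) x) ⟩
    c + x * ((x - r) * Q + E)         ≡⟨ solve 5 (λ c x r Q E → c :+ x :* ((x :- r) :* Q :+ E)
                                                := (x :- r) :* (E :+ x :* Q) :+ (c :+ r :* E)) refl c x r Q E ⟩
    (x - r) * (E + x * Q) + (c + r * E) ∎
    where
    Q : Carrier
    Q = eval (quotient r (d ∷ cs)) x
    E : Carrier
    E = eval (d ∷ cs) r

  length-quotient : ∀ r P → length (quotient r P) ≡ length P ∸ 1
  length-quotient r []           = refl
  length-quotient r (c ∷ [])     = refl
  length-quotient r (c ∷ d ∷ cs) = cong suc (length-quotient r (d ∷ cs))

  quotient≡0∧root⇒≡0 : ∀ r P → All (_≡ 0#) (quotient r P) → eval P r ≡ 0# → All (_≡ 0#) P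
  quotient≡0∧root⇒≡0 r []           _             _      = []
  quotient≡0∧root⇒≡0 r (c ∷ [])     _             P[r]≡0 =
    trans (solve 2 (λ c r → c := c :+ r :* :0) refl c r) P[r]≡0 ∷ []
  quotient≡0∧root⇒≡0 r (c ∷ d ∷ cs) (Q[r]≡0 ∷ Q≡0) P[r]≡0 =
    c≡0 ∷ quotient≡0∧root⇒≡0 r (d ∷ cs) Q≡0 Q[r]≡0
    where
    c≡0 : c ≡ 0#
    c≡0 = begin
      c                      ≡⟨ solve 2 (λ c r → c := c :+ r :* :0) refl c r ⟩
      c + r * 0#             ≡⟨ cong (λ e → c + r * e) Q[r]≡0 ⟨
      c + r * eval (d ∷ cs) r ≡⟨ P[r]≡0 ⟩
      0#                     ∎

  many-roots⇒zero : ∀ {xs} P → Unique xs → All (λ x → eval P x ≡ 0#) xs →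
                    length P ℕ.≤ length xs → All (_≡ 0#) P
  many-roots⇒zero {[]}     []      _              _               _   = []
  many-roots⇒zero {r ∷ rs} P       (r≢rs ∷ rs-unique) (P[r]≡0 ∷ P[rs]≡0) |P|≤ =
    quotient≡0∧root⇒≡0 r P
      (many-roots⇒zero (quotient r P) rs-unique (All.zipWith root (r≢rs , P[rs]≡0)) |Q|≤) P[r]≡0
    where
    |Q|≤ : length (quotient r P) ℕ.≤ length rs
    |Q|≤ = subst (ℕ._≤ length rs) (sym (length-quotient r P)) (ℕₚ.∸-monoˡ-≤ 1 |P|≤)
    root : ∀ {y} → r ≢ y × eval P y ≡ 0# → eval (quotient r P) y ≡ 0#
    root {y} (r≢y , P[y]≡0) = x≢0⇒x*y≡0⇒y≡0 (x≢y⇒x-y≢0 (r≢y ∘ sym)) (begin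
      (y - r) * eval (quotient r P) y            ≡⟨ +-identityʳ _ ⟨
      (y - r) * eval (quotient r P) y + 0#       ≡⟨ cong ((y - r) * eval (quotient r P) y +_) P[r]≡0 ⟨
      (y - r) * eval (quotient r P) y + eval P r ≡⟨ eval≡[x-r]*quotient+eval[r] r P y ⟨
      eval P y                                   ≡⟨ P[y]≡0 ⟩
      0#                                         ∎)

  eval-zeros++ : ∀ j P x → eval (replicate j 0# ++ P) x ≡ x ^ᶠ j * eval P x
  eval-zeros++ zero    P x = sym (*-identityˡ _)
  eval-zeros++ (suc j) P x = begin
    0# + x * eval (replicate j 0# ++ P) x ≡⟨ cong (λ e → 0# + x * e) (eval-zeros++ j P x) ⟩
    0# + x * (x ^ᶠ j * eval P x)          ≡⟨ solve 3 (λ x a e → :0 :+ x :* (a :* e) := (x :* a) :* e)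
                                                    refl x (x ^ᶠ j) (eval P x) ⟩
    (x * x ^ᶠ j) * eval P x               ∎

  AtMost-x^k≡b*x : ∀ {k} → 2 ℕ.≤ k → ∀ b → AtMost k (λ x → x ^ᶠ k ≡ b * x)
  AtMost-x^k≡b*x {1} (s≤s ())
  AtMost-x^k≡b*x {suc (suc j)} _ b {xs} xs-unique roots with length xs ℕₚ.≤? suc (suc j)
  ... | yes |xs|≤k = |xs|≤k
  ... | no  |xs|≰k = ⊥-elim (1≢0 (All.head (Allₚ.++⁻ʳ (replicate j 0#) (All.tail (All.tail P≡0)))))
    where
    P : Polynomial
    P = 0# ∷ - b ∷ replicate j 0# ++ 1# ∷ []
    |P|≡k+1 : length P ≡ suc (suc (suc j))
    |P|≡k+1 = cong (suc ∘ suc) (trans (length-++ (replicate j 0#))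
                                      (trans (cong (ℕ._+ 1) (length-replicate j)) (ℕₚ.+-comm j 1)))
    P[x]≡x^k-b*x : ∀ x → eval P x ≡ x ^ᶠ suc (suc j) - b * x
    P[x]≡x^k-b*x x = begin
      0# + x * (- b + x * eval (replicate j 0# ++ 1# ∷ []) x)
        ≡⟨ cong (λ e → 0# + x * (- b + x * e)) (eval-zeros++ j (1# ∷ []) x) ⟩
      0# + x * (- b + x * (x ^ᶠ j * (1# + x * 0#)))
        ≡⟨ solve 3 (λ x b a → :0 :+ x :* (:- b :+ x :* (a :* (:1 :+ x :* :0))) := x :* (x :* a) :- b :* x)
             refl x b (x ^ᶠ j) ⟩
      x * (x * x ^ᶠ j) - b * x
        ∎
    P≡0 : All (_≡ 0#) P
    P≡0 = many-roots⇒zero P xs-unique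
      (All.map (λ {x} x^k≡bx → trans (P[x]≡x^k-b*x x) (trans (cong (_- b * x) x^k≡bx) (-‿inverseʳ _))) roots)
      (subst (ℕ._≤ length xs) (sym |P|≡k+1) (ℕₚ.≰⇒> |xs|≰k))
    1≢0 : 1# ≢ 0#
    1≢0 = 0≢1 ∘ sym

module FiniteField (F : Field) {N : ℕ} (enum : Fin N ↔ Field.Carrier F) where

  open FieldProperties F
  open Polynomials F using (AtMost-x^k≡b*x)
  open ≡-Reasoning
  open Inverse enum using (to; from; strictlyInverseˡ; strictlyInverseʳ)
  open Injection (Inverse⇒Injection enum) using () renaming (injective to to-injective)
  open Injection (Inverse⇒Injection (↔-sym enum)) using () renaming (injective to from-injective)

  infix 4 _≟_
  _≟_ : DecidableEquality Carrier
  _≟_ = via-injection (Inverse⇒Injection (↔-sym enum)) Fin._≟_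

  elements : List Carrier
  elements = tabulate to

  elements-unique : Unique elements
  elements-unique = Uniqueₚ.tabulate⁺ to-injective

  ∈-elements : ∀ x → x ∈ elements
  ∈-elements x = subst (_∈ elements) (strictlyInverseˡ x) (∈-tabulate⁺ (from x))

  AtMost⇒N≤ : ∀ {k P} → AtMost k P → (∀ x → P x) → N ℕ.≤ k
  AtMost⇒N≤ {k} atMost all =
    subst (ℕ._≤ k) (length-tabulate to) (atMost elements-unique (Allₚ.tabulate⁺ (all ∘ to)))

  ¬∀⇒∃¬ : ∀ {P : Carrier → Set} → Decidable P → ¬ (∀ x → P x) → ∃ λ x → ¬ P x
  ¬∀⇒∃¬ {P} P? ¬all
    with Finₚ.¬∀⟶∃¬ N (P ∘ to) (P? ∘ to) (λ all → ¬all (λ x → subst P (strictlyInverseˡ x) (all (from x))))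
  ... | i , ¬P[i] = to i , ¬P[i]

  AtMost⇒∃¬ : ∀ {k P} → Decidable P → AtMost k P → k ℕ.< N → ∃ λ x → ¬ P x
  AtMost⇒∃¬ P? atMost k<N = ¬∀⇒∃¬ P? (ℕₚ.<⇒≱ k<N ∘ AtMost⇒N≤ atMost)

  injective-pair⇒N≤ : ∀ {k l P Q} → Decidable P → Decidable Q → AtMost k P → AtMost l Q →
                      (g h : Carrier → Carrier) → (∀ x → P (g x)) → (∀ x → Q (h x)) →
                      (∀ {x y} → g x ≡ g y → h x ≡ h y → x ≡ y) → N ℕ.≤ k ℕ.* l
  injective-pair⇒N≤ {k} {l} P? Q? atMostP atMostQ g h P[g] Q[h] gh-injective =
    ℕₚ.≤-trans (Finₚ.injective⇒≤ code-injective)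
               (ℕₚ.*-mono-≤ (atMostP (Uniqueₚ.filter⁺ P? elements-unique) (Allₚ.all-filter P? elements))
                            (atMostQ (Uniqueₚ.filter⁺ Q? elements-unique) (Allₚ.all-filter Q? elements)))
    where
    Ps : List Carrier
    Ps = filter P? elements
    Qs : List Carrier
    Qs = filter Q? elements
    g∈Ps : ∀ x → g x ∈ Ps
    g∈Ps x = ∈-filter⁺ P? (∈-elements (g x)) (P[g] x)
    h∈Qs : ∀ x → h x ∈ Qs
    h∈Qs x = ∈-filter⁺ Q? (∈-elements (h x)) (Q[h] x)
    code : Fin N → Fin (length Ps ℕ.* length Qs)
    code i = Fin.combine (Any.index (g∈Ps (to i))) (Any.index (h∈Qs (to i)))
    code-injective : Injective _≡_ _≡_ code
    code-injective {i} {j} code≡ with Finₚ.combine-injective _ _ _ _ code≡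
    ... | gᵢ≡gⱼ , hᵢ≡hⱼ = to-injective (gh-injective
      (index-injective (setoid Carrier) (g∈Ps (to i)) (g∈Ps (to j)) gᵢ≡gⱼ)
      (index-injective (setoid Carrier) (h∈Qs (to i)) (h∈Qs (to j)) hᵢ≡hⱼ))

  module _ {c ℓ} (M : CommutativeMonoid c ℓ) where

    private module M = CommutativeMonoid M
    open import Algebra.Properties.CommutativeMonoid.Sum M using (sum; sum-permute; sum-cong-≗)

    ∑ : (Carrier → M.Carrier) → M.Carrier
    ∑ u = sum (u ∘ to)

    ∑-reindex : (π : Carrier ↔ Carrier) (u : Carrier → M.Carrier) → ∑ u M.≈ ∑ (u ∘ Inverse.to π)
    ∑-reindex π u =
      M.trans (sum-permute (u ∘ to) (↔-sym enum ↔-∘ (π ↔-∘ enum)))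
              (M.reflexive (sum-cong-≗ {N} (λ i → cong u (strictlyInverseˡ (Inverse.to π (to i))))))

  N·1≡0 : N · 1# ≡ 0#
  N·1≡0 = +-cancelˡ S (N · 1#) 0# (begin
    S + N · 1#                    ≡⟨ cong (S +_) (sum-replicate N) ⟨
    S + sum {N} (λ _ → 1#)        ≡⟨ ∑-distrib-+ to (λ _ → 1#) ⟨
    ∑ +-commutativeMonoid (_+ 1#) ≡⟨ ∑-reindex +-commutativeMonoid (translation 1#) id ⟨
    S                             ≡⟨ +-identityʳ S ⟨
    S + 0#                        ∎)
    where
    open import Algebra.Properties.CommutativeMonoid.Sum +-commutativeMonoid
      using (sum; sum-replicate; ∑-distrib-+)
    S : Carrier
    S = ∑ +-commutativeMonoid id

  private
    unit : Carrier → Carrier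
    unit x with x ≟ 0#
    ... | yes _ = 1#
    ... | no  _ = x

    unit≢0 : ∀ x → unit x ≢ 0#
    unit≢0 x with x ≟ 0#
    ... | yes _   = 0≢1 ∘ sym
    ... | no  x≢0 = x≢0

    unit-≢0 : ∀ {x} → x ≢ 0# → unit x ≡ x
    unit-≢0 {x} x≢0 with x ≟ 0#
    ... | yes x≡0 = ⊥-elim (x≢0 x≡0)
    ... | no  _   = refl

  -- Multiplication by c ≢ 0 permutes the field and fixes 0; unit replaces 0 by 1, so the
  -- product P of all unit x is nonzero and c ^ N * P = c * P.
  x^N≡x : ∀ c → c ^ᶠ N ≡ c
  x^N≡x c with c ≟ 0#
  ... | yes refl = 0^ᶠn≡0 N {{Finₚ.nonZeroIndex (from 0#)}}
  ... | no  c≢0  = *-cancelˡ P≢0 (begin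
    P * c ^ᶠ N                 ≡⟨ *-comm P _ ⟩
    c ^ᶠ N * P                 ≡⟨ product-scale c (unit ∘ to) ⟨
    ∏ (λ x → c * unit x)       ≡⟨ product-update _ _ (from 0#) c scale-at-0 scale-elsewhere ⟩
    c * ∏ (λ x → unit (c * x)) ≡⟨ cong (c *_) (∑-reindex *-commutativeMonoid (scaling c≢0) unit) ⟨
    c * P                      ≡⟨ *-comm c P ⟩
    P * c                      ∎)
    where
    ∏ : (Carrier → Carrier) → Carrier
    ∏ = ∑ *-commutativeMonoid
    P : Carrier
    P = ∏ unit
    P≢0 : P ≢ 0#
    P≢0 = product-≢0 (unit ∘ to) (unit≢0 ∘ to)
    scale-at-0 : c * unit (to (from 0#)) ≡ c * unit (c * to (from 0#))
    scale-at-0 rewrite strictlyInverseˡ 0# | zeroʳ c = refl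
    scale-elsewhere : ∀ i → i ≢ from 0# → c * unit (to i) ≡ unit (c * to i)
    scale-elsewhere i i≢ = trans (cong (c *_) (unit-≢0 to[i]≢0)) (sym (unit-≢0 (*-≢0 c≢0 to[i]≢0)))
      where
      to[i]≢0 : to i ≢ 0#
      to[i]≢0 to[i]≡0 = i≢ (trans (sym (strictlyInverseʳ i)) (cong from to[i]≡0))

  injective⇒bijective : ∀ {f : Carrier → Carrier} → Injective _≡_ _≡_ f → Bijective _≡_ _≡_ f
  injective⇒bijective {f} f-injective = f-injective , surjective
    where
    surjective : Surjective _≡_ _≡_ f
    surjective y
      with Fin-injective⇒surjective {f = from ∘ f ∘ to} (to-injective ∘ f-injective ∘ from-injective) (from y)
    ... | i , f̂[i]≡y =
      to i , λ { refl → trans (sym (strictlyInverseˡ _)) (trans (cong to f̂[i]≡y) (strictlyInverseˡ y)) }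

  ∃-root-of-unity≢1 : ∀ n d → 1 ℕ.≤ n → 2 ℕ.≤ d → N ≡ suc (n ℕ.* d) →
                      ∃ λ y → y ≢ 1# × y ^ᶠ d ≡ 1#
  ∃-root-of-unity≢1 n d 1≤n 2≤d N≡1+nd
    with AtMost⇒∃¬ (λ x → x ^ᶠ suc n ≟ 1# * x) (AtMost-x^k≡b*x (s≤s 1≤n) 1#) 1+n<N
    where
    1+n<N : suc n ℕ.< N
    1+n<N = subst (suc n ℕ.<_) (sym N≡1+nd) (s≤s (ℕₚ.m<m*n n d {{ℕ.>-nonZero 1≤n}} 2≤d))
  ... | x , x^[1+n]≢x = x ^ᶠ n , x^n≢1 , *-cancelˡ x≢0 (begin
    x * (x ^ᶠ n) ^ᶠ d    ≡⟨ cong (x *_) (^ᶠ-*-assoc x n d) ⟩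
    x ^ᶠ suc (n ℕ.* d)   ≡⟨ cong (x ^ᶠ_) N≡1+nd ⟨
    x ^ᶠ N               ≡⟨ x^N≡x x ⟩
    x                    ≡⟨ *-identityʳ x ⟨
    x * 1#               ∎)
    where
    x^n≢1 : x ^ᶠ n ≢ 1#
    x^n≢1 x^n≡1 = x^[1+n]≢x (trans (cong (x *_) x^n≡1) (*-comm x 1#))
    x≢0 : x ≢ 0#
    x≢0 refl = x^[1+n]≢x (trans (zeroˡ _) (sym (zeroʳ 1#)))

record IsCubicAutomorphism (F : Field) (φ : Field.Carrier F → Field.Carrier F) : Set where
  open Field F
  field
    φ-+   : ∀ x y → φ (x + y) ≡ φ x + φ y
    φ-*   : ∀ x y → φ (x * y) ≡ φ x * φ y
    φ³≡id : ∀ x → φ (φ (φ x)) ≡ x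

module CubicAutomorphism
  (F : Field) {φ : Field.Carrier F → Field.Carrier F} (isCubic : IsCubicAutomorphism F φ)
  where

  open FieldProperties F
  open IsCubicAutomorphism isCubic
  open ≡-Reasoning

  φ-injective : ∀ {x y} → φ x ≡ φ y → x ≡ y
  φ-injective {x} {y} φx≡φy = trans (sym (φ³≡id x)) (trans (cong (φ ∘ φ) φx≡φy) (φ³≡id y))

  φ-0 : φ 0# ≡ 0#
  φ-0 = +-cancelˡ (φ 0#) (φ 0#) 0# (begin
    φ 0# + φ 0# ≡⟨ φ-+ 0# 0# ⟨
    φ (0# + 0#) ≡⟨ cong φ (+-identityʳ 0#) ⟩
    φ 0#        ≡⟨ +-identityʳ (φ 0#) ⟨
    φ 0# + 0#   ∎)

  φ-1 : φ 1# ≡ 1#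
  φ-1 = *-cancelˡ φ1≢0 (begin
    φ 1# * φ 1# ≡⟨ φ-* 1# 1# ⟨
    φ (1# * 1#) ≡⟨ cong φ (*-identityʳ 1#) ⟩
    φ 1#        ≡⟨ *-identityʳ (φ 1#) ⟨
    φ 1# * 1#   ∎)
    where
    φ1≢0 : φ 1# ≢ 0#
    φ1≢0 φ1≡0 = 0≢1 (φ-injective (trans φ-0 (sym φ1≡0)))

  φ-sub : ∀ x y → φ (x - y) ≡ φ x - φ y
  φ-sub x y = trans (φ-+ x (- y)) (cong (φ x +_) φ[-y]≡-φy)
    where
    φ[-y]≡-φy : φ (- y) ≡ - φ y
    φ[-y]≡-φy = +-cancelˡ (φ y) _ _ (begin
      φ y + φ (- y) ≡⟨ φ-+ y (- y) ⟨
      φ (y - y)     ≡⟨ cong φ (-‿inverseʳ y) ⟩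
      φ 0#          ≡⟨ φ-0 ⟩
      0#            ≡⟨ -‿inverseʳ (φ y) ⟨
      φ y - φ y     ∎)

  φ-^ᶠ : ∀ x n → φ (x ^ᶠ n) ≡ φ x ^ᶠ n
  φ-^ᶠ x zero    = φ-1
  φ-^ᶠ x (suc n) = trans (φ-* x (x ^ᶠ n)) (cong (φ x *_) (φ-^ᶠ x n))

  Fixed : Carrier → Set
  Fixed x = φ x ≡ x

  Fixed-* : ∀ {x y} → Fixed x → Fixed y → Fixed (x * y)
  Fixed-* {x} {y} φx≡x φy≡y = trans (φ-* x y) (cong₂ _*_ φx≡x φy≡y)

  Fixed-sub : ∀ {x y} → Fixed x → Fixed y → Fixed (x - y)
  Fixed-sub {x} {y} φx≡x φy≡y = trans (φ-sub x y) (cong₂ _-_ φx≡x φy≡y)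

  Fixed-^ᶠ : ∀ {x} n → Fixed x → Fixed (x ^ᶠ n)
  Fixed-^ᶠ {x} n φx≡x = trans (φ-^ᶠ x n) (cong (_^ᶠ n) φx≡x)

  Fixed-inverse : ∀ {x y} → Fixed x → x * y ≡ 1# → Fixed y
  Fixed-inverse {x} {y} φx≡x xy≡1 = *-cancelˡ x≢0 (begin
    x * φ y   ≡⟨ cong (_* φ y) φx≡x ⟨
    φ x * φ y ≡⟨ φ-* x y ⟨
    φ (x * y) ≡⟨ cong φ xy≡1 ⟩
    φ 1#      ≡⟨ φ-1 ⟩
    1#        ≡⟨ xy≡1 ⟨
    x * y     ∎)
    where
    x≢0 : x ≢ 0#
    x≢0 refl = 0≢1 (trans (sym (zeroˡ y)) xy≡1)

  -- For φ x = x ^ q, Lin c₀ c₁ c₂ is the linearised polynomial c₀ X + c₁ X^q + c₂ X^{q²}.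
  Lin : Carrier → Carrier → Carrier → Carrier → Carrier
  Lin c₀ c₁ c₂ x = c₀ * x + c₁ * φ x + c₂ * φ (φ x)

  Lin-cong : ∀ {c₀ c₁ c₂ d₀ d₁ d₂} x → c₀ ≡ d₀ → c₁ ≡ d₁ → c₂ ≡ d₂ →
             Lin c₀ c₁ c₂ x ≡ Lin d₀ d₁ d₂ x
  Lin-cong x refl refl refl = refl

  Lin-sub : ∀ c₀ c₁ c₂ x y → Lin c₀ c₁ c₂ (x - y) ≡ Lin c₀ c₁ c₂ x - Lin c₀ c₁ c₂ y
  Lin-sub c₀ c₁ c₂ x y = begin
    c₀ * (x - y) + c₁ * φ (x - y) + c₂ * φ (φ (x - y))
      ≡⟨ cong₂ (λ u v → c₀ * (x - y) + c₁ * u + c₂ * v) (φ-sub x y) (trans (cong φ (φ-sub x y)) (φ-sub _ _)) ⟩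
    c₀ * (x - y) + c₁ * (φ x - φ y) + c₂ * (φ (φ x) - φ (φ y))
      ≡⟨ solve 9 (λ c₀ c₁ c₂ x y x₁ y₁ x₂ y₂ →
                    c₀ :* (x :- y) :+ c₁ :* (x₁ :- y₁) :+ c₂ :* (x₂ :- y₂)
                    := (c₀ :* x :+ c₁ :* x₁ :+ c₂ :* x₂) :- (c₀ :* y :+ c₁ :* y₁ :+ c₂ :* y₂))
                 refl c₀ c₁ c₂ x y (φ x) (φ y) (φ (φ x)) (φ (φ y)) ⟩
    Lin c₀ c₁ c₂ x - Lin c₀ c₁ c₂ y
      ∎

  *-Lin : ∀ c c₀ c₁ c₂ x → c * Lin c₀ c₁ c₂ x ≡ Lin (c * c₀) (c * c₁) (c * c₂) x
  *-Lin c c₀ c₁ c₂ x = solve 7 (λ c c₀ c₁ c₂ x x₁ x₂ → c :* (c₀ :* x :+ c₁ :* x₁ :+ c₂ :* x₂)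
                                  := (c :* c₀) :* x :+ (c :* c₁) :* x₁ :+ (c :* c₂) :* x₂)
                               refl c c₀ c₁ c₂ x (φ x) (φ (φ x))

  Lin-+ : ∀ c₀ c₁ c₂ d₀ d₁ d₂ x →
          Lin c₀ c₁ c₂ x + Lin d₀ d₁ d₂ x ≡ Lin (c₀ + d₀) (c₁ + d₁) (c₂ + d₂) x
  Lin-+ c₀ c₁ c₂ d₀ d₁ d₂ x =
    solve 9 (λ c₀ c₁ c₂ d₀ d₁ d₂ x x₁ x₂ →
               (c₀ :* x :+ c₁ :* x₁ :+ c₂ :* x₂) :+ (d₀ :* x :+ d₁ :* x₁ :+ d₂ :* x₂)
               := (c₀ :+ d₀) :* x :+ (c₁ :+ d₁) :* x₁ :+ (c₂ :+ d₂) :* x₂)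
            refl c₀ c₁ c₂ d₀ d₁ d₂ x (φ x) (φ (φ x))

  Lin-scale : ∀ c₀ c₁ c₂ {c} x → Fixed c → Lin c₀ c₁ c₂ (c * x) ≡ c * Lin c₀ c₁ c₂ x
  Lin-scale c₀ c₁ c₂ {c} x φc≡c = begin
    c₀ * (c * x) + c₁ * φ (c * x) + c₂ * φ (φ (c * x))
      ≡⟨ cong₂ (λ u v → c₀ * (c * x) + c₁ * u + c₂ * v) φ[cx]≡cφx
               (trans (cong φ φ[cx]≡cφx) (trans (φ-* c (φ x)) (cong (_* φ (φ x)) φc≡c))) ⟩
    c₀ * (c * x) + c₁ * (c * φ x) + c₂ * (c * φ (φ x))
      ≡⟨ solve 7 (λ c₀ c₁ c₂ c x x₁ x₂ → c₀ :* (c :* x) :+ c₁ :* (c :* x₁) :+ c₂ :* (c :* x₂)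
                    := c :* (c₀ :* x :+ c₁ :* x₁ :+ c₂ :* x₂)) refl c₀ c₁ c₂ c x (φ x) (φ (φ x)) ⟩
    c * Lin c₀ c₁ c₂ x
      ∎
    where
    φ[cx]≡cφx : φ (c * x) ≡ c * φ x
    φ[cx]≡cφx = trans (φ-* c x) (cong (_* φ x) φc≡c)

  φ-Lin : ∀ c₀ c₁ c₂ x → φ (Lin c₀ c₁ c₂ x) ≡ Lin (φ c₂) (φ c₀) (φ c₁) x
  φ-Lin c₀ c₁ c₂ x = begin
    φ (c₀ * x + c₁ * φ x + c₂ * φ (φ x))
      ≡⟨ trans (φ-+ _ _) (cong₂ _+_ (φ-+ _ _) refl) ⟩
    φ (c₀ * x) + φ (c₁ * φ x) + φ (c₂ * φ (φ x))
      ≡⟨ cong₂ _+_ (cong₂ _+_ (φ-* c₀ x) (φ-* c₁ (φ x))) (trans (φ-* c₂ _) (cong (φ c₂ *_) (φ³≡id x))) ⟩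
    φ c₀ * φ x + φ c₁ * φ (φ x) + φ c₂ * x
      ≡⟨ solve 6 (λ a b c x x₁ x₂ → a :* x₁ :+ b :* x₂ :+ c :* x := c :* x :+ a :* x₁ :+ b :* x₂)
           refl (φ c₀) (φ c₁) (φ c₂) x (φ x) (φ (φ x)) ⟩
    Lin (φ c₂) (φ c₀) (φ c₁) x
      ∎

  trace : Carrier → Carrier
  trace = Lin 1# 1# 1#

  Fixed-trace : ∀ x → Fixed (trace x)
  Fixed-trace x = trans (φ-Lin 1# 1# 1# x) (Lin-cong x φ-1 φ-1 φ-1)

  trace-φ : ∀ x → trace (φ x) ≡ trace x
  trace-φ x = begin
    1# * φ x + 1# * φ (φ x) + 1# * φ (φ (φ x)) ≡⟨ cong (λ t → 1# * φ x + 1# * φ (φ x) + 1# * t) (φ³≡id x) ⟩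
    1# * φ x + 1# * φ (φ x) + 1# * x           ≡⟨ solve 3 (λ x x₁ x₂ → :1 :* x₁ :+ :1 :* x₂ :+ :1 :* x
                                                                 := :1 :* x :+ :1 :* x₁ :+ :1 :* x₂)
                                                            refl x (φ x) (φ (φ x)) ⟩
    trace x                                    ∎

  norm : Carrier → Carrier
  norm b = b * (φ b * φ (φ b))

  norm-* : ∀ b c → norm (b * c) ≡ norm b * norm c
  norm-* b c = begin
    (b * c) * (φ (b * c) * φ (φ (b * c)))
      ≡⟨ cong₂ (λ u v → (b * c) * (u * v)) (φ-* b c) (trans (cong φ (φ-* b c)) (φ-* _ _)) ⟩
    (b * c) * ((φ b * φ c) * (φ (φ b) * φ (φ c)))
      ≡⟨ solve 6 (λ b c b₁ c₁ b₂ c₂ → (b :* c) :* ((b₁ :* c₁) :* (b₂ :* c₂))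
                                      := (b :* (b₁ :* b₂)) :* (c :* (c₁ :* c₂)))
           refl b c (φ b) (φ c) (φ (φ b)) (φ (φ c)) ⟩
    norm b * norm c
      ∎

  norm≡1⇒norm[b*b]≡1 : ∀ {b} → norm b ≡ 1# → norm (b * b) ≡ 1#
  norm≡1⇒norm[b*b]≡1 {b} norm[b]≡1 = trans (norm-* b b) (trans (cong₂ _*_ norm[b]≡1 norm[b]≡1) (*-identityˡ 1#))

  eigenMap : Carrier → Carrier → Carrier
  eigenMap b = Lin (b * φ (φ b)) b 1#

  φ-eigenMap : ∀ {b} → norm b ≡ 1# → ∀ x → φ (eigenMap b x) ≡ φ b * eigenMap b x
  φ-eigenMap {b} norm[b]≡1 x = begin
    φ (eigenMap b x)                                 ≡⟨ φ-Lin _ _ _ x ⟩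
    Lin (φ 1#) (φ (b * φ (φ b))) (φ b) x             ≡⟨ Lin-cong x (trans φ-1 (sym φb*[b*φφb]≡1))
                                                                   (trans (φ-* b _) (cong (φ b *_) (φ³≡id b)))
                                                                   (sym (*-identityʳ (φ b))) ⟩
    Lin (φ b * (b * φ (φ b))) (φ b * b) (φ b * 1#) x ≡⟨ *-Lin (φ b) _ _ _ x ⟨
    φ b * eigenMap b x                               ∎
    where
    φb*[b*φφb]≡1 : φ b * (b * φ (φ b)) ≡ 1#
    φb*[b*φφb]≡1 = trans (solve 3 (λ b b₁ b₂ → b₁ :* (b :* b₂) := b :* (b₁ :* b₂)) refl b (φ b) (φ (φ b)))
                         norm[b]≡1

  linearPart : Carrier → Carrier → Carrier
  linearPart a = Lin (a * φ (φ a) + (a * φ (φ a)) * (a * φ (φ a))) (a + a * a) (1# + 1#)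

  linearPart≡eigenMap+eigenMap : ∀ a x → linearPart a x ≡ eigenMap a x + eigenMap (a * a) x
  linearPart≡eigenMap+eigenMap a x =
    sym (trans (Lin-+ _ _ _ _ _ _ x) (Lin-cong x (cong (a * φ (φ a) +_) aa*φφ[aa]≡[aφφa]²) refl refl))
    where
    aa*φφ[aa]≡[aφφa]² : (a * a) * φ (φ (a * a)) ≡ (a * φ (φ a)) * (a * φ (φ a))
    aa*φφ[aa]≡[aφφa]² = trans (cong ((a * a) *_) (trans (cong φ (φ-* a a)) (φ-* _ _)))
                              (solve 2 (λ a a₂ → (a :* a) :* (a₂ :* a₂) := (a :* a₂) :* (a :* a₂)) refl a (φ (φ a)))

  c*A+c²*B≡A+B⇒A+[c+1]*B≡0 : ∀ {c A B} → c ≢ 1# → c * A + (c * c) * B ≡ A + B → A + (c + 1#) * B ≡ 0#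
  c*A+c²*B≡A+B⇒A+[c+1]*B≡0 {c} {A} {B} c≢1 eq = x≢0⇒x*y≡0⇒y≡0 (x≢y⇒x-y≢0 c≢1) (begin
    (c - 1#) * (A + (c + 1#) * B)   ≡⟨ solve 3 (λ c A B → (c :- :1) :* (A :+ (c :+ :1) :* B)
                                                          := (c :* A :+ (c :* c) :* B) :- (A :+ B)) refl c A B ⟩
    (c * A + (c * c) * B) - (A + B) ≡⟨ cong (_- (A + B)) eq ⟩
    (A + B) - (A + B)               ≡⟨ -‿inverseʳ _ ⟩
    0#                              ∎)

  -- Applying φ and φ² to the fixed element A + B gives two relations of the shape above, with
  -- c and c φ(c); their difference isolates c (1 − φ c) B.
  eigen-sum-fixed⇒zero : ∀ {c A B} → c ≢ 0# → c ≢ 1# → φ c ≢ 1# → c * φ c ≢ 1# →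
                         φ A ≡ c * A → φ B ≡ (c * c) * B → Fixed (A + B) → A ≡ 0# × B ≡ 0#
  eigen-sum-fixed⇒zero {c} {A} {B} c≢0 c≢1 φc≢1 cφc≢1 φA≡cA φB≡ccB A+B-fixed = A≡0 , B≡0
    where
    d : Carrier
    d = c * φ c
    φ²-eigen : ∀ {e V} → φ V ≡ e * V → φ (φ V) ≡ (e * φ e) * V
    φ²-eigen {e} {V} φV≡eV = trans (cong φ φV≡eV) (trans (φ-* e V) (trans (cong (φ e *_) φV≡eV)
                               (solve 3 (λ e e₁ V → e₁ :* (e :* V) := (e :* e₁) :* V) refl e (φ e) V)))
    d*d≡cc*φ[cc] : d * d ≡ (c * c) * φ (c * c)
    d*d≡cc*φ[cc] = trans (solve 2 (λ c c₁ → (c :* c₁) :* (c :* c₁) := (c :* c) :* (c₁ :* c₁)) refl c (φ c))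
                         (cong ((c * c) *_) (sym (φ-* c c)))
    line₁ : A + (c + 1#) * B ≡ 0#
    line₁ = c*A+c²*B≡A+B⇒A+[c+1]*B≡0 c≢1 (begin
      c * A + (c * c) * B ≡⟨ cong₂ _+_ φA≡cA φB≡ccB ⟨
      φ A + φ B           ≡⟨ φ-+ A B ⟨
      φ (A + B)           ≡⟨ A+B-fixed ⟩
      A + B               ∎)
    line₂ : A + (d + 1#) * B ≡ 0#
    line₂ = c*A+c²*B≡A+B⇒A+[c+1]*B≡0 cφc≢1 (begin
      d * A + (d * d) * B                 ≡⟨ cong₂ (λ u v → u + v * B) (φ²-eigen φA≡cA) (sym d*d≡cc*φ[cc]) ⟨
      φ (φ A) + ((c * c) * φ (c * c)) * B ≡⟨ cong (φ (φ A) +_) (φ²-eigen φB≡ccB) ⟨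
      φ (φ A) + φ (φ B)                   ≡⟨ trans (cong φ (φ-+ A B)) (φ-+ _ _) ⟨
      φ (φ (A + B))                       ≡⟨ trans (cong φ A+B-fixed) A+B-fixed ⟩
      A + B                               ∎)
    B≡0 : B ≡ 0#
    B≡0 = x≢0⇒x*y≡0⇒y≡0 (*-≢0 c≢0 (x≢y⇒x-y≢0 (φc≢1 ∘ sym))) (begin
      (c * (1# - φ c)) * B                    ≡⟨ solve 4 (λ c c₁ A B → (c :* (:1 :- c₁)) :* B
                                                            := (A :+ (c :+ :1) :* B) :- (A :+ (c :* c₁ :+ :1) :* B))
                                                   refl c (φ c) A B ⟩
      (A + (c + 1#) * B) - (A + (d + 1#) * B) ≡⟨ cong₂ _-_ line₁ line₂ ⟩
      0# - 0#                                 ≡⟨ -‿inverseʳ 0# ⟩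
      0#                                      ∎)
    A≡0 : A ≡ 0#
    A≡0 = begin
      A                                 ≡⟨ solve 3 (λ c A B → A := (A :+ (c :+ :1) :* B) :- (c :+ :1) :* B) refl c A B ⟩
      (A + (c + 1#) * B) - (c + 1#) * B ≡⟨ cong₂ (λ u v → u - (c + 1#) * v) line₁ B≡0 ⟩
      0# - (c + 1#) * 0#                ≡⟨ solve 1 (λ c → :0 :- (c :+ :1) :* :0 := :0) refl c ⟩
      0#                                ∎

  eigenMaps∩trace-kernel≡0 : ∀ {b z} → b ≢ 0# → φ (φ b) ≢ 1# → b * φ (φ b) ≢ 1# →
                             eigenMap b z ≡ 0# → eigenMap (b * b) z ≡ 0# → trace z ≡ 0# → z ≡ 0#
  eigenMaps∩trace-kernel≡0 {b} {z} b≢0 b₂≢1 bb₂≢1 M[z]≡0 M²[z]≡0 T[z]≡0 =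
    x≢0⇒x*y≡0⇒y≡0 (*-≢0 (x≢y⇒x-y≢0 bb₂≢1) (*-≢0 b≢0 (x≢y⇒x-y≢0 (b₂≢1 ∘ sym)))) (begin
      ((b * b₂ - 1#) * (b * (1# - b₂))) * z
        ≡⟨ solve 5 (λ b b₂ z z₁ z₂ →
              ((b :* b₂ :- :1) :* (b :* (:1 :- b₂))) :* z
              := (b :+ :1) :* ((b :* b₂ :* z :+ b :* z₁ :+ :1 :* z₂) :- (:1 :* z :+ :1 :* z₁ :+ :1 :* z₂))
                 :- (((b :* b) :* (b₂ :* b₂)) :* z :+ (b :* b) :* z₁ :+ :1 :* z₂
                     :- (:1 :* z :+ :1 :* z₁ :+ :1 :* z₂)))
             refl b b₂ z (φ z) (φ (φ z)) ⟩
      (b + 1#) * (eigenMap b z - trace z) - (Lin ((b * b) * (b₂ * b₂)) (b * b) 1# z - trace z)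
        ≡⟨ cong (λ e → (b + 1#) * (eigenMap b z - trace z) - (Lin ((b * b) * e) (b * b) 1# z - trace z))
                (trans (cong φ (φ-* b b)) (φ-* _ _)) ⟨
      (b + 1#) * (eigenMap b z - trace z) - (eigenMap (b * b) z - trace z)
        ≡⟨ cong₂ (λ u v → (b + 1#) * (u - trace z) - (v - trace z)) M[z]≡0 M²[z]≡0 ⟩
      (b + 1#) * (0# - trace z) - (0# - trace z)
        ≡⟨ cong (λ t → (b + 1#) * (0# - t) - (0# - t)) T[z]≡0 ⟩
      (b + 1#) * (0# - 0#) - (0# - 0#)
        ≡⟨ solve 1 (λ b → (b :+ :1) :* (:0 :- :0) :- (:0 :- :0) := :0) refl b ⟩
      0#
        ∎)
    where
    b₂ : Carrier
    b₂ = φ (φ b)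

  module _ {a} (norm[a]≡1 : norm a ≡ 1#) (a≢1 : a ≢ 1#) where

    private
      φa≢1 : φ a ≢ 1#
      φa≢1 φa≡1 = a≢1 (φ-injective (trans φa≡1 (sym φ-1)))
      φφa≢1 : φ (φ a) ≢ 1#
      φφa≢1 φφa≡1 = φa≢1 (φ-injective (trans φφa≡1 (sym φ-1)))
      a≢0 : a ≢ 0#
      a≢0 refl = 0≢1 (trans (sym (zeroˡ _)) norm[a]≡1)
      φa≢0 : φ a ≢ 0#
      φa≢0 φa≡0 = a≢0 (φ-injective (trans φa≡0 (sym φ-0)))
      φa*φφa≢1 : φ a * φ (φ a) ≢ 1#
      φa*φφa≢1 e = a≢1 (trans (sym (*-identityʳ a)) (trans (cong (a *_) (sym e)) norm[a]≡1))
      a*φφa≢1 : a * φ (φ a) ≢ 1#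
      a*φφa≢1 e = φa≢1 (trans (sym (*-identityʳ (φ a))) (trans (cong (φ a *_) (sym e)) (trans
                    (solve 3 (λ a a₁ a₂ → a₁ :* (a :* a₂) := a :* (a₁ :* a₂)) refl a (φ a) (φ (φ a))) norm[a]≡1)))

    Fixed[linearPart]⇒eigenMaps≡0 : ∀ {z} → Fixed (linearPart a z) →
                                    eigenMap a z ≡ 0# × eigenMap (a * a) z ≡ 0#
    Fixed[linearPart]⇒eigenMaps≡0 {z} L[z]-fixed =
      eigen-sum-fixed⇒zero φa≢0 φa≢1 φφa≢1 φa*φφa≢1 (φ-eigenMap norm[a]≡1 z)
        (trans (φ-eigenMap (norm≡1⇒norm[b*b]≡1 norm[a]≡1) z) (cong (_* eigenMap (a * a) z) (φ-* a a)))
        (subst Fixed (linearPart≡eigenMap+eigenMap a z) L[z]-fixed)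

    linearPart+P∘trace-injective : (P : Carrier → Carrier) → (∀ {t} → Fixed t → Fixed (P t)) →
                                   (∀ {t u} → Fixed t → Fixed u → P t ≡ P u → t ≡ u) →
                                   Injective _≡_ _≡_ (λ x → linearPart a x + P (trace x))
    linearPart+P∘trace-injective P P-fixed P-injective {x} {y} fx≡fy = x∙y⁻¹≈ε⇒x≈y x y z≡0
      where
      L : Carrier → Carrier
      L = linearPart a
      z : Carrier
      z = x - y
      γ : Carrier
      γ = P (trace y) - P (trace x)
      L[z]≡γ : L z ≡ γ
      L[z]≡γ = begin
        L (x - y)                                       ≡⟨ Lin-sub _ _ _ x y ⟩
        L x - L y                                       ≡⟨ solve 4 (λ lx ly px py →
                                                                      lx :- ly := ((lx :+ px) :- (ly :+ py)) :+ (py :- px))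
                                                             refl (L x) (L y) (P (trace x)) (P (trace y)) ⟩
        ((L x + P (trace x)) - (L y + P (trace y))) + γ ≡⟨ cong (λ e → (e - (L y + P (trace y))) + γ) fx≡fy ⟩
        ((L y + P (trace y)) - (L y + P (trace y))) + γ ≡⟨ cong (_+ γ) (-‿inverseʳ _) ⟩
        0# + γ                                          ≡⟨ +-identityˡ γ ⟩
        γ                                               ∎
      eigenMaps≡0 : eigenMap a z ≡ 0# × eigenMap (a * a) z ≡ 0#
      eigenMaps≡0 = Fixed[linearPart]⇒eigenMaps≡0
        (subst Fixed (sym L[z]≡γ) (Fixed-sub (P-fixed (Fixed-trace y)) (P-fixed (Fixed-trace x))))
      L[z]≡0 : L z ≡ 0#
      L[z]≡0 = trans (linearPart≡eigenMap+eigenMap a z)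
                     (trans (cong₂ _+_ (proj₁ eigenMaps≡0) (proj₂ eigenMaps≡0)) (+-identityʳ 0#))
      trace[x]≡trace[y] : trace x ≡ trace y
      trace[x]≡trace[y] = P-injective (Fixed-trace x) (Fixed-trace y)
                                      (sym (x∙y⁻¹≈ε⇒x≈y _ _ (trans (sym L[z]≡γ) L[z]≡0)))
      z≡0 : z ≡ 0#
      z≡0 = eigenMaps∩trace-kernel≡0 a≢0 φφa≢1 a*φφa≢1 (proj₁ eigenMaps≡0) (proj₂ eigenMaps≡0)
              (trans (Lin-sub 1# 1# 1# x y) (trans (cong (_- trace y) trace[x]≡trace[y]) (-‿inverseʳ _)))

  linearPart[1]≡2*trace : ∀ x → linearPart 1# x ≡ 2# * trace x
  linearPart[1]≡2*trace x = begin
    linearPart 1# x                     ≡⟨ Lin-cong x (trans (cong₂ (λ u v → u + v * v) 1*φφ1≡1 1*φφ1≡1) 1+1*1≡2*1)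
                                                      1+1*1≡2*1 (sym (*-identityʳ 2#)) ⟩
    Lin (2# * 1#) (2# * 1#) (2# * 1#) x ≡⟨ *-Lin 2# 1# 1# 1# x ⟨
    2# * trace x                        ∎
    where
    1*φφ1≡1 : 1# * φ (φ 1#) ≡ 1#
    1*φφ1≡1 = trans (*-identityˡ _) (trans (cong φ φ-1) φ-1)
    1+1*1≡2*1 : 1# + 1# * 1# ≡ 2# * 1#
    1+1*1≡2*1 = trans (cong (1# +_) (*-identityʳ 1#)) (sym (*-identityʳ 2#))

  trace[0]≡0 : trace 0# ≡ 0#
  trace[0]≡0 = trans (cong trace (sym (-‿inverseʳ 0#))) (trans (Lin-sub 1# 1# 1# 0# 0#) (-‿inverseʳ _))

  not-injective-at-1 : ∀ {a} → a ≡ 1# → (∃ λ c → ¬ Fixed c) → (P : Carrier → Carrier) →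
                       ¬ Injective _≡_ _≡_ (λ x → linearPart a x + P (trace x))
  not-injective-at-1 refl (c , φc≢c) P f-injective = x≢0 (f-injective (begin
    linearPart 1# x + P (trace x)   ≡⟨ cong (_+ P (trace x)) (linearPart[1]≡2*trace x) ⟩
    2# * trace x + P (trace x)      ≡⟨ cong (λ t → 2# * t + P t) (trans trace[x]≡0 (sym trace[0]≡0)) ⟩
    2# * trace 0# + P (trace 0#)    ≡⟨ cong (_+ P (trace 0#)) (linearPart[1]≡2*trace 0#) ⟨
    linearPart 1# 0# + P (trace 0#) ∎))
    where
    x : Carrier
    x = c - φ c
    x≢0 : x ≢ 0#
    x≢0 = x≢y⇒x-y≢0 (φc≢c ∘ sym)
    trace[x]≡0 : trace x ≡ 0#
    trace[x]≡0 = trans (Lin-sub 1# 1# 1# c (φ c)) (trans (cong (λ t → trace c - t) (trace-φ c)) (-‿inverseʳ _))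

  not-injective-on-kernel : ∀ {a y z} (P : Carrier → Carrier) → z ≢ 0# → linearPart a z ≡ 0# →
                            y ≢ 1# → Fixed y → (∀ {t} → Fixed t → P (y * t) ≡ P t) →
                            ¬ Injective _≡_ _≡_ (λ x → linearPart a x + P (trace x))
  not-injective-on-kernel {a} {y} {z} P z≢0 L[z]≡0 y≢1 y-fixed P[y*t]≡P[t] f-injective =
    y≢1 (*-cancelˡ z≢0 (trans (*-comm z y) (trans yz≡z (sym (*-identityʳ z)))))
    where
    L : Carrier → Carrier
    L = linearPart a
    yz≡z : y * z ≡ z
    yz≡z = f-injective (begin
      L (y * z) + P (trace (y * z)) ≡⟨ cong₂ (λ u v → u + P v) (Lin-scale _ _ _ z y-fixed)
                                                               (Lin-scale 1# 1# 1# z y-fixed) ⟩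
      y * L z + P (y * trace z)     ≡⟨ cong₂ (λ u v → y * u + v) L[z]≡0 (P[y*t]≡P[t] (Fixed-trace z)) ⟩
      y * 0# + P (trace z)          ≡⟨ cong (_+ P (trace z)) (trans (zeroʳ y) (sym L[z]≡0)) ⟩
      L z + P (trace z)             ∎)

module CubicExtension
  (p m : ℕ) (pp : Prime p) (1≤m : 1 ℕ.≤ m)
  (F : Field) (enum : Fin (p ℕ.^ (3 ℕ.* m)) ↔ Field.Carrier F)
  where

  open FieldProperties F
  open Frobenius F using (frobenius-^)
  open Polynomials F using (AtMost-x^k≡b*x)
  open FiniteField F enum
  open ≡-Reasoning

  q N : ℕ
  q = p ℕ.^ m
  N = p ℕ.^ (3 ℕ.* m)

  2≤q : 2 ℕ.≤ q
  2≤q = ℕₚ.≤-trans (prime⇒1<p pp)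
          (subst (ℕ._≤ q) (ℕₚ.*-identityʳ p) (ℕₚ.^-monoʳ-≤ p {{prime⇒nonZero pp}} 1≤m))

  q≡1+[q∸1] : q ≡ suc (q ∸ 1)
  q≡1+[q∸1] = trans (sym (ℕₚ.m∸n+n≡m (ℕₚ.<⇒≤ 2≤q))) (ℕₚ.+-comm (q ∸ 1) 1)

  q∸1≢0 : q ∸ 1 ≢ 0
  q∸1≢0 q∸1≡0 = ℕₚ.<⇒≱ 2≤q (ℕₚ.≤-reflexive (trans q≡1+[q∸1] (cong suc q∸1≡0)))

  N≡q*[q*q] : N ≡ q ℕ.* (q ℕ.* q)
  N≡q*[q*q] = begin
    p ℕ.^ (3 ℕ.* m)         ≡⟨ cong (p ℕ.^_) (ℕₚ.*-comm 3 m) ⟩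
    p ℕ.^ (m ℕ.* 3)         ≡⟨ ℕₚ.^-*-assoc p m 3 ⟨
    q ℕ.* (q ℕ.* (q ℕ.* 1)) ≡⟨ cong (λ t → q ℕ.* (q ℕ.* t)) (ℕₚ.*-identityʳ q) ⟩
    q ℕ.* (q ℕ.* q)         ∎

  N≡1+[q∸1]*[q²+q+1] : N ≡ suc ((q ∸ 1) ℕ.* (q ℕ.* q ℕ.+ q ℕ.+ 1))
  N≡1+[q∸1]*[q²+q+1] = begin
    N                                             ≡⟨ N≡q*[q*q] ⟩
    q ℕ.* (q ℕ.* q)                               ≡⟨ cong (λ t → t ℕ.* (t ℕ.* t)) q≡1+[q∸1] ⟩
    suc k ℕ.* (suc k ℕ.* suc k)                   ≡⟨ [1+k]³≡1+k*[[1+k]²+[1+k]+1] k ⟩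
    suc (k ℕ.* (suc k ℕ.* suc k ℕ.+ suc k ℕ.+ 1)) ≡⟨ cong (λ t → suc (k ℕ.* (t ℕ.* t ℕ.+ t ℕ.+ 1)))
                                                          q≡1+[q∸1] ⟨
    suc (k ℕ.* (q ℕ.* q ℕ.+ q ℕ.+ 1))             ∎
    where
    k : ℕ
    k = q ∸ 1

  q*q<N : q ℕ.* q ℕ.< N
  q*q<N = subst (q ℕ.* q ℕ.<_) (trans (ℕₚ.*-comm (q ℕ.* q) q) (sym N≡q*[q*q]))
            (ℕₚ.m<m*n (q ℕ.* q) q {{ℕ.>-nonZero (ℕₚ.*-mono-≤ (ℕₚ.<⇒≤ 2≤q) (ℕₚ.<⇒≤ 2≤q))}} 2≤q)

  q<N : q ℕ.< N
  q<N = ℕₚ.≤-<-trans (ℕₚ.m≤m*n q q {{ℕ.>-nonZero (ℕₚ.<⇒≤ 2≤q)}}) q*q<N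

  p·1≡0 : p · 1# ≡ 0#
  p·1≡0 = decidable-stable (p · 1# ≟ 0#) λ p·1≢0 →
    ^ᶠ-≢0 (3 ℕ.* m) p·1≢0 (trans (sym (·1-homo-^ p (3 ℕ.* m))) N·1≡0)

  φ : Carrier → Carrier
  φ x = x ^ᶠ q

  φ³≡id : ∀ x → φ (φ (φ x)) ≡ x
  φ³≡id x = begin
    ((x ^ᶠ q) ^ᶠ q) ^ᶠ q  ≡⟨ cong (_^ᶠ q) (^ᶠ-*-assoc x q q) ⟩
    (x ^ᶠ (q ℕ.* q)) ^ᶠ q ≡⟨ ^ᶠ-*-assoc x (q ℕ.* q) q ⟩
    x ^ᶠ (q ℕ.* q ℕ.* q)  ≡⟨ cong (x ^ᶠ_) (trans (ℕₚ.*-assoc q q q) (sym N≡q*[q*q])) ⟩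
    x ^ᶠ N                ≡⟨ x^N≡x x ⟩
    x                     ∎

  isCubicAutomorphism : IsCubicAutomorphism F φ
  isCubicAutomorphism = record
    { φ-+   = frobenius-^ pp p·1≡0 m
    ; φ-*   = λ x y → ^ᶠ-distribʳ-* x y q
    ; φ³≡id = φ³≡id
    }

  open CubicAutomorphism F isCubicAutomorphism public

  x^[q²]≡φφx : ∀ x → x ^ᶠ (q ℕ.^ 2) ≡ φ (φ x)
  x^[q²]≡φφx x = trans (cong (λ e → x ^ᶠ (q ℕ.* e)) (ℕₚ.*-identityʳ q)) (sym (^ᶠ-*-assoc x q q))

  a^[q²+q+1]≡norm : ∀ a → a ^ᶠ (q ℕ.^ 2 ℕ.+ q ℕ.+ 1) ≡ norm a
  a^[q²+q+1]≡norm a = begin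
    a ^ᶠ (q ℕ.^ 2 ℕ.+ q ℕ.+ 1)    ≡⟨ ^ᶠ-distribˡ-+-* a (q ℕ.^ 2 ℕ.+ q) 1 ⟩
    a ^ᶠ (q ℕ.^ 2 ℕ.+ q) * a ^ᶠ 1 ≡⟨ cong₂ _*_ (^ᶠ-distribˡ-+-* a (q ℕ.^ 2) q) (*-identityʳ a) ⟩
    (a ^ᶠ (q ℕ.^ 2) * φ a) * a    ≡⟨ cong (λ t → (t * φ a) * a) (x^[q²]≡φφx a) ⟩
    (φ (φ a) * φ a) * a           ≡⟨ solve 3 (λ a a₁ a₂ → (a₂ :* a₁) :* a := a :* (a₁ :* a₂)) refl a (φ a) (φ (φ a)) ⟩
    norm a                        ∎

  f5≗linearPart+trace^s : ∀ a s → f5 F q a s ≗ λ x → linearPart a x + trace x ^ᶠ s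
  f5≗linearPart+trace^s a s x = cong₂ (λ u v → u + v ^ᶠ s) linear Tr≡trace
    where
    c : Carrier
    c = a * φ (φ a)
    n : ℕ
    n = 1 ℕ.+ q ℕ.^ 2
    a^n≡c : a ^ᶠ n ≡ c
    a^n≡c = cong (a *_) (x^[q²]≡φφx a)
    a^2n≡c*c : a ^ᶠ (2 ℕ.* n) ≡ c * c
    a^2n≡c*c = trans (^ᶠ-distribˡ-+-* a n (n ℕ.+ 0))
                     (cong₂ _*_ a^n≡c (trans (cong (a ^ᶠ_) (ℕₚ.+-identityʳ n)) a^n≡c))
    linear : 2# * x ^ᶠ (q ℕ.^ 2) + (a + a ^ᶠ 2) * φ x + (a ^ᶠ n + a ^ᶠ (2 ℕ.* n)) * x ≡ linearPart a x
    linear = begin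
      2# * x ^ᶠ (q ℕ.^ 2) + (a + a ^ᶠ 2) * φ x + (a ^ᶠ n + a ^ᶠ (2 ℕ.* n)) * x
        ≡⟨ cong₂ (λ u v → 2# * u + (a + a * v) * φ x + (a ^ᶠ n + a ^ᶠ (2 ℕ.* n)) * x)
                 (x^[q²]≡φφx x) (*-identityʳ a) ⟩
      2# * φ (φ x) + (a + a * a) * φ x + (a ^ᶠ n + a ^ᶠ (2 ℕ.* n)) * x
        ≡⟨ cong (λ u → 2# * φ (φ x) + (a + a * a) * φ x + u * x) (cong₂ _+_ a^n≡c a^2n≡c*c) ⟩
      2# * φ (φ x) + (a + a * a) * φ x + (c + c * c) * x
        ≡⟨ solve 5 (λ c a x x₁ x₂ → (:1 :+ :1) :* x₂ :+ (a :+ a :* a) :* x₁ :+ (c :+ c :* c) :* x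
                                    := (c :+ c :* c) :* x :+ (a :+ a :* a) :* x₁ :+ (:1 :+ :1) :* x₂)
             refl c a x (φ x) (φ (φ x)) ⟩
      linearPart a x
        ∎
    Tr≡trace : Tr F q x ≡ trace x
    Tr≡trace = trans (cong (λ u → x + φ x + u) (x^[q²]≡φφx x))
                     (solve 3 (λ x x₁ x₂ → x :+ x₁ :+ x₂ := :1 :* x :+ :1 :* x₁ :+ :1 :* x₂) refl x (φ x) (φ (φ x)))

  AtMost-eigenspace : ∀ c → AtMost q (λ v → φ v ≡ c * v)
  AtMost-eigenspace = AtMost-x^k≡b*x 2≤q

  ∃-non-fixed : ∃ λ c → ¬ Fixed c
  ∃-non-fixed with AtMost⇒∃¬ (λ v → φ v ≟ 1# * v) (AtMost-eigenspace 1#) q<N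
  ... | c , φc≢1*c = c , λ φc≡c → φc≢1*c (trans φc≡c (sym (*-identityˡ c)))

  -- Otherwise z ↦ (eigenMap a z, eigenMap (a * a) z) would be injective, sending the q³ elements
  -- into two eigenspaces of at most q elements each.
  ∃-nonzero-root : ∀ {a} → norm a ≡ 1# → ∃ λ z → z ≢ 0# × linearPart a z ≡ 0#
  ∃-nonzero-root {a} norm[a]≡1 = nonzero-root (¬∀⇒∃¬ (λ z → (linearPart a z ≟ 0#) →-dec (z ≟ 0#)) kernel≢0)
    where
    M M² : Carrier → Carrier
    M  = eigenMap a
    M² = eigenMap (a * a)
    M,M²-injective : (∀ z → linearPart a z ≡ 0# → z ≡ 0#) → ∀ {x y} → M x ≡ M y → M² x ≡ M² y → x ≡ y
    M,M²-injective kernel≡0 {x} {y} Mx≡My M²x≡M²y = x∙y⁻¹≈ε⇒x≈y x y (kernel≡0 (x - y) (begin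
      linearPart a (x - y)              ≡⟨ linearPart≡eigenMap+eigenMap a (x - y) ⟩
      M (x - y) + M² (x - y)            ≡⟨ cong₂ _+_ (Lin-sub _ _ _ x y) (Lin-sub _ _ _ x y) ⟩
      (M x - M y) + (M² x - M² y)       ≡⟨ cong₂ (λ u v → (u - M y) + (v - M² y)) Mx≡My M²x≡M²y ⟩
      (M y - M y) + (M² y - M² y)       ≡⟨ cong₂ _+_ (-‿inverseʳ _) (-‿inverseʳ _) ⟩
      0# + 0#                           ≡⟨ +-identityʳ 0# ⟩
      0#                                ∎))
    kernel≢0 : ¬ (∀ z → linearPart a z ≡ 0# → z ≡ 0#)
    kernel≢0 kernel≡0 = ℕₚ.<⇒≱ q*q<N
      (injective-pair⇒N≤ (λ v → φ v ≟ φ a * v) (λ v → φ v ≟ φ (a * a) * v)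
        (AtMost-eigenspace _) (AtMost-eigenspace _) M M²
        (φ-eigenMap norm[a]≡1) (φ-eigenMap (norm≡1⇒norm[b*b]≡1 norm[a]≡1)) (M,M²-injective kernel≡0))
    nonzero-root : (∃ λ z → ¬ (linearPart a z ≡ 0# → z ≡ 0#)) → ∃ λ z → z ≢ 0# × linearPart a z ≡ 0#
    nonzero-root (z , ¬[L[z]≡0⇒z≡0]) =
      z , (λ z≡0 → ¬[L[z]≡0⇒z≡0] (λ _ → z≡0)) ,
      decidable-stable (linearPart a z ≟ 0#) (λ L[z]≢0 → ¬[L[z]≡0⇒z≡0] (⊥-elim ∘ L[z]≢0))

  Fixed⇒^[q∸1]≡1 : ∀ {t} → Fixed t → t ≢ 0# → t ^ᶠ (q ∸ 1) ≡ 1#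
  Fixed⇒^[q∸1]≡1 {t} t-fixed t≢0 = *-cancelˡ t≢0 (begin
    t ^ᶠ suc (q ∸ 1) ≡⟨ cong (t ^ᶠ_) q≡1+[q∸1] ⟨
    t ^ᶠ q           ≡⟨ t-fixed ⟩
    t                ≡⟨ *-identityʳ t ⟨
    t * 1#           ∎)

  ^[q∸1]≡1⇒Fixed : ∀ {y} → y ^ᶠ (q ∸ 1) ≡ 1# → Fixed y
  ^[q∸1]≡1⇒Fixed {y} y^[q∸1]≡1 = begin
    y ^ᶠ q           ≡⟨ cong (y ^ᶠ_) q≡1+[q∸1] ⟩
    y * y ^ᶠ (q ∸ 1) ≡⟨ cong (y *_) y^[q∸1]≡1 ⟩
    y * 1#           ≡⟨ *-identityʳ y ⟩
    y                ∎

  Fixed∧^s≡1⇒≡1 : ∀ {s r} .{{_ : NonZero s}} → gcd s (q ∸ 1) ≡ 1 → Fixed r → r ^ᶠ s ≡ 1# → r ≡ 1#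
  Fixed∧^s≡1⇒≡1 {s} {r} gcd≡1 r-fixed r^s≡1 = begin
    r                  ≡⟨ *-identityʳ r ⟨
    r ^ᶠ 1             ≡⟨ cong (r ^ᶠ_) gcd≡1 ⟨
    r ^ᶠ gcd s (q ∸ 1) ≡⟨ ^ᶠ≡1-gcd s (q ∸ 1) r^s≡1 (Fixed⇒^[q∸1]≡1 r-fixed r≢0) ⟩
    1#                 ∎
    where
    r≢0 : r ≢ 0#
    r≢0 refl = 0≢1 (trans (sym (0^ᶠn≡0 s)) r^s≡1)

  ^s-injective-on-Fixed : ∀ {s} .{{_ : NonZero s}} → gcd s (q ∸ 1) ≡ 1 →
                          ∀ {t u} → Fixed t → Fixed u → t ^ᶠ s ≡ u ^ᶠ s → t ≡ u
  ^s-injective-on-Fixed {s} gcd≡1 {t} {u} t-fixed u-fixed t^s≡u^s with u ≟ 0#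
  ... | yes refl = decidable-stable (t ≟ 0#) λ t≢0 → ^ᶠ-≢0 s t≢0 (trans t^s≡u^s (0^ᶠn≡0 s))
  ... | no  u≢0  = begin
    t             ≡⟨ *-identityʳ t ⟨
    t * 1#        ≡⟨ cong (t *_) u⁻¹*u≡1 ⟨
    t * (u⁻¹ * u) ≡⟨ *-assoc t u⁻¹ u ⟨
    (t * u⁻¹) * u ≡⟨ cong (_* u) (Fixed∧^s≡1⇒≡1 gcd≡1 (Fixed-* t-fixed u⁻¹-fixed) [tu⁻¹]^s≡1) ⟩
    1# * u        ≡⟨ *-identityˡ u ⟩
    u             ∎
    where
    u⁻¹ : Carrier
    u⁻¹ = proj₁ (inverse u u≢0)
    u*u⁻¹≡1 : u * u⁻¹ ≡ 1#
    u*u⁻¹≡1 = proj₂ (inverse u u≢0)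
    u⁻¹*u≡1 : u⁻¹ * u ≡ 1#
    u⁻¹*u≡1 = trans (*-comm u⁻¹ u) u*u⁻¹≡1
    u⁻¹-fixed : Fixed u⁻¹
    u⁻¹-fixed = Fixed-inverse u-fixed u*u⁻¹≡1
    [tu⁻¹]^s≡1 : (t * u⁻¹) ^ᶠ s ≡ 1#
    [tu⁻¹]^s≡1 = begin
      (t * u⁻¹) ^ᶠ s    ≡⟨ ^ᶠ-distribʳ-* t u⁻¹ s ⟩
      t ^ᶠ s * u⁻¹ ^ᶠ s ≡⟨ cong (_* u⁻¹ ^ᶠ s) t^s≡u^s ⟩
      u ^ᶠ s * u⁻¹ ^ᶠ s ≡⟨ ^ᶠ-distribʳ-* u u⁻¹ s ⟨
      (u * u⁻¹) ^ᶠ s    ≡⟨ cong (_^ᶠ s) u*u⁻¹≡1 ⟩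
      1# ^ᶠ s           ≡⟨ 1^ᶠn≡1 s ⟩
      1#                ∎

  ∃-fixed-root-of-unity≢1 : ∀ {d s} → 2 ℕ.≤ d → d ∣ q ∸ 1 → d ∣ s →
                            ∃ λ y → y ≢ 1# × Fixed y × y ^ᶠ s ≡ 1#
  ∃-fixed-root-of-unity≢1 {d} {s} 2≤d d∣q∸1 d∣s =
    fixed (∃-root-of-unity≢1 (k′ ℕ.* r) d 1≤k′r 2≤d N≡1+k′rd)
    where
    k′ : ℕ
    k′ = _∣_.quotient d∣q∸1
    q∸1≡k′d : q ∸ 1 ≡ k′ ℕ.* d
    q∸1≡k′d = _∣_.equality d∣q∸1
    r : ℕ
    r = q ℕ.* q ℕ.+ q ℕ.+ 1
    1≤k′ : 1 ℕ.≤ k′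
    1≤k′ = ℕₚ.n≢0⇒n>0 λ k′≡0 → q∸1≢0 (trans q∸1≡k′d (cong (ℕ._* d) k′≡0))
    1≤k′r : 1 ℕ.≤ k′ ℕ.* r
    1≤k′r = ℕₚ.*-mono-≤ 1≤k′ (ℕₚ.m≤n+m 1 (q ℕ.* q ℕ.+ q))
    N≡1+k′rd : N ≡ suc (k′ ℕ.* r ℕ.* d)
    N≡1+k′rd = trans N≡1+[q∸1]*[q²+q+1] (cong suc (trans (cong (ℕ._* r) q∸1≡k′d) (xy∙z≈xz∙y k′ d r)))
    fixed : (∃ λ y → y ≢ 1# × y ^ᶠ d ≡ 1#) → ∃ λ y → y ≢ 1# × Fixed y × y ^ᶠ s ≡ 1#
    fixed (y , y≢1 , y^d≡1) = y , y≢1 , ^[q∸1]≡1⇒Fixed (^ᶠ≡1-∣ d∣q∸1 y^d≡1) , ^ᶠ≡1-∣ d∣s y^d≡1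

  module F5 {a} (a^[q²+q+1]≡1 : a ^ᶠ (q ℕ.^ 2 ℕ.+ q ℕ.+ 1) ≡ 1#) (s : ℕ) .{{_ : NonZero s}} where

    private
      norm[a]≡1 : norm a ≡ 1#
      norm[a]≡1 = trans (sym (a^[q²+q+1]≡norm a)) a^[q²+q+1]≡1
      f5≗ : f5 F q a s ≗ λ x → linearPart a x + trace x ^ᶠ s
      f5≗ = f5≗linearPart+trace^s a s

    f5-injective : a ≢ 1# → gcd s (q ∸ 1) ≡ 1 → Injective _≡_ _≡_ (f5 F q a s)
    f5-injective a≢1 gcd≡1 = injective-≗ (sym ∘ f5≗)
      (linearPart+P∘trace-injective norm[a]≡1 a≢1 (_^ᶠ s) (Fixed-^ᶠ s) (^s-injective-on-Fixed gcd≡1))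

    f5-injective⇒a≢1 : Injective _≡_ _≡_ (f5 F q a s) → a ≢ 1#
    f5-injective⇒a≢1 f-injective a≡1 =
      not-injective-at-1 a≡1 ∃-non-fixed (_^ᶠ s) (injective-≗ f5≗ f-injective)

    f5-injective⇒gcd≡1 : Injective _≡_ _≡_ (f5 F q a s) → gcd s (q ∸ 1) ≡ 1
    f5-injective⇒gcd≡1 f-injective = decidable-stable (gcd s (q ∸ 1) ℕ.≟ 1) λ gcd≢1 →
      let z , z≢0 , L[z]≡0 = ∃-nonzero-root norm[a]≡1
          y , y≢1 , y-fixed , y^s≡1 = ∃-fixed-root-of-unity≢1 (≢0∧≢1⇒2≤ (q∸1≢0 ∘ gcd[m,n]≡0⇒n≡0 s) gcd≢1)
                                                             (gcd[m,n]∣n s (q ∸ 1)) (gcd[m,n]∣m s (q ∸ 1))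
      in not-injective-on-kernel (_^ᶠ s) z≢0 L[z]≡0 y≢1 y-fixed
           (λ {t} _ → trans (^ᶠ-distribʳ-* y t s) (trans (cong (_* t ^ᶠ s) y^s≡1) (*-identityˡ _)))
           (injective-≗ f5≗ f-injective)

open import Data.Nat using (_+_; _*_; _^_; _≤_; _<_)

theorem3p5 : (p m s : ℕ) → Prime p → 1 ≤ m → 1 < s →
    (F : Field) → Fin (p ^ (3 * m)) ↔ Field.Carrier F →
    (a : Field.Carrier F) →
    Field._^ᶠ_ F a ((p ^ m) ^ 2 + p ^ m + 1) ≡ Field.1# F →
    Bijective _≡_ _≡_ (f5 F (p ^ m) a s)
    ⇔ (a ≢ Field.1# F × gcd s (p ^ m ∸ 1) ≡ 1)
theorem3p5 p m s pp 1≤m 1<s F enum a a^[q²+q+1]≡1 = mk⇔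
  (λ (f-injective , _) → f5-injective⇒a≢1 f-injective , f5-injective⇒gcd≡1 f-injective)
  (λ (a≢1 , gcd≡1) → injective⇒bijective (f5-injective a≢1 gcd≡1))
  where
  instance
    s≢0 : NonZero s
    s≢0 = ℕ.>-nonZero (ℕₚ.<⇒≤ 1<s)
  open FiniteField F enum using (injective⇒bijective)
  open CubicExtension p m pp 1≤m F enum using (module F5)
  open F5 a^[q²+q+1]≡1 s
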